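{- Let $\mathbf{k}\in\mathbb{N}[\Phi]^W$. (1) For every $w\in W$, the linear map $v\mapsto w(v)$ is an automorphism of the undirected graph $\Gamma^{\mathrm{un}}_{\mathrm{sym},\mathbf{k}}$. (2) For every $w\in C$, the affine map $v\mapsto w(v-\frac1h\rho)+\frac1h\rho$ is an automorphism of the undirected graph $\Gamma^{\mathrm{un}}_{\mathrm{tr},\mathbf{k}}$.
   Context: Let $V$ be a finite-dimensional real inner product space and $\Phi\subseteq V$ an irreducible (reduced, crystallographic) root system spanning $V$, with $\alpha^\vee=2\alpha/\langle\alpha,\alpha\rangle$, simple roots $\alpha_1,\dots,\alpha_n$, positive roots $\Phi^+$, Weyl group $W$, fundamental weights $\omega_i$ ($\langle\omega_i,\alpha_j^\vee\rangle=\delta_{ij}$), weight lattice $P=\bigoplus\mathbb{Z}\omega_i$. Let $\rho=\sum_i\omega_i$. The coroots $\Phi^\vee=\{\alpha^\vee\}$ form a root system with simple roots $\alpha_1^\vee,\dots,\alpha_n^\vee$; let $\widehat\theta^\vee$ be its highest root. The Coxeter number is $h=\langle\rho,\widehat\theta^\vee\rangle+1$, and $C=\{w\in W:\rho-w(\rho)\in hP\}$. $\mathbb{N}[\Phi]^W$ is the set of $W$-invariant functions $\mathbf{k}\colon\Phi\to\mathbb{Z}_{\ge0}$. The symmetric relation: $\lambda\to_{\mathrm{sym},\mathbf{k}}\lambda+\alpha$ for $\lambda\in P$, $\alpha\in\Phi^+$ with $\langle\lambda,\alpha^\vee\rangle+1\in\{ -\mathbf{k}(\alpha),\dots,\mathbf{k}(\alpha)\}$;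 the truncated relation: $\lambda\to_{\mathrm{tr},\mathbf{k}}\lambda+\alpha$ when $\langle\lambda,\alpha^\vee\rangle+1\in\{ -\mathbf{k}(\alpha)+1,\dots,\mathbf{k}(\alpha)\}$. $\Gamma^{\mathrm{un}}_{\mathrm{sym},\mathbf{k}}$ (resp. $\Gamma^{\mathrm{un}}_{\mathrm{tr},\mathbf{k}}$) is the graph on vertex set $P$ with an edge between $\lambda$ and $\mu$ whenever $\lambda\to\mu$ or $\mu\to\lambda$ for the respective relation. An automorphism is a bijection of $P$ preserving adjacency.
   Formalization: The space V is taken as ℚ^n, with its inner product given by a rational Gram matrix, rather than a finite-dimensional real inner product space. -}

module Defs where

open import Data.Nat as ℕ using (ℕ; zero; suc)
open import Data.Integer as ℤ using (ℤ; +_)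
open import Data.Rational as ℚ using (ℚ; 0ℚ; 1ℚ; _+_; _*_; _-_; -_; _<_)
open import Data.Rational.Properties as ℚP using ()
open import Data.Fin as Fin using (Fin)
open import Data.Vec as Vec using (Vec; zipWith; map; replicate; lookup)
open import Data.List as List using (List; length; foldr)
open import Data.List.Membership.Propositional using (_∈_; _∉_)
open import Data.List.Relation.Unary.All using (All)
open import Data.Bool using (Bool; true; false)
open import Data.Product using (Σ; ∃; _×_; _,_)
open import Data.Sum using (_⊎_)
open import Function.Bundles using (_⇔_)
open import Relation.Nullary using (¬_; yes; no)
open import Relation.Binary.PropositionalEquality using (_≡_; _≢_)

V : ℕ → Set
V n = Vec ℚ n

module _ {n : ℕ} where

  infixl 6 _⊕_ _⊖_
  infixl 7 _·_

  _⊕_ : V n → V n → V n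
  _⊕_ = zipWith _+_

  _⊖_ : V n → V n → V n
  _⊖_ = zipWith _-_

  _·_ : ℚ → V n → V n
  c · v = map (c *_) v

  𝟎 : V n
  𝟎 = replicate n 0ℚ

sumQ : ∀ {m} → (Fin m → ℚ) → ℚ
sumQ {zero}  f = 0ℚ
sumQ {suc m} f = f Fin.zero + sumQ (λ i → f (Fin.suc i))

sumV : ∀ {n m} → (Fin m → V n) → V n
sumV {n} {zero}  f = 𝟎
sumV {n} {suc m} f = f Fin.zero ⊕ sumV (λ i → f (Fin.suc i))

ι : ℤ → ℚ
ι m = m ℚ./ 1

-- total inverse on ℚ (inv 0 = 0); only applied to nonzero numbers below
inv : ℚ → ℚ
inv q with q ℚP.≟ 0ℚ
... | yes _  = 0ℚ
... | no q≢0 = ℚ.1/_ q {{ℚ.≢-nonZero q≢0}}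

δ : ∀ {n} → Fin n → Fin n → ℚ
δ i j with i Fin.≟ j
... | yes _ = 1ℚ
... | no _  = 0ℚ

IsInt : ℚ → Set
IsInt q = ∃ λ (m : ℤ) → q ≡ ι m

Form : ℕ → Set
Form n = Fin n → Fin n → ℚ

module _ {n : ℕ} (M : Form n) where

  ⟪_,_⟫ : V n → V n → ℚ
  ⟪ u , v ⟫ = sumQ λ i → sumQ λ j → lookup u i * M i j * lookup v j

  IsInnerProduct : Set
  IsInnerProduct = (∀ i j → M i j ≡ M j i) × (∀ v → v ≢ 𝟎 → 0ℚ < ⟪ v , v ⟫)

  coroot : V n → V n
  coroot α = (ι (+ 2) * inv ⟪ α , α ⟫) · α

  pair : V n → V n → ℚ
  pair v α = ⟪ v , coroot α ⟫

  reflect : V n → V n → V n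
  reflect α v = v ⊖ (pair v α · α)

  record IsRootSystem (Φ : List (V n)) : Set where
    field
      spans      : ∀ v → ∃ λ (c : Fin (length Φ) → ℚ) →
                     v ≡ sumV (λ i → c i · List.lookup Φ i)
      zero∉      : 𝟎 ∉ Φ
      reflClosed : ∀ α β → α ∈ Φ → β ∈ Φ → reflect α β ∈ Φ
      integral   : ∀ α β → α ∈ Φ → β ∈ Φ → IsInt (pair β α)
      reduced    : ∀ α c → α ∈ Φ → c · α ∈ Φ → c ≡ 1ℚ ⊎ c ≡ - 1ℚ

  IsIrreducible : List (V n) → Set
  IsIrreducible Φ = ¬ (Σ (V n → Bool) λ S →
      (∃ λ α → α ∈ Φ × S α ≡ true) ×
      (∃ λ β → β ∈ Φ × S β ≡ false) ×
      (∀ α β → α ∈ Φ → β ∈ Φ → S α ≡ true → S β ≡ false → ⟪ α , β ⟫ ≡ 0ℚ))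

  record IsBase (Φ : List (V n)) (Δ : Fin n → V n) : Set where
    field
      simple∈   : ∀ i → Δ i ∈ Φ
      linIndep  : ∀ (c : Fin n → ℚ) → sumV (λ i → c i · Δ i) ≡ 𝟎 → ∀ i → c i ≡ 0ℚ
      signed    : ∀ α → α ∈ Φ → ∃ λ (c : Fin n → ℤ) →
                    α ≡ sumV (λ i → ι (c i) · Δ i) ×
                    ((∀ i → + 0 ℤ.≤ c i) ⊎ (∀ i → c i ℤ.≤ + 0))

  IsPositive : (Fin n → V n) → V n → Set
  IsPositive Δ α = ∃ λ (c : Fin n → ℕ) → α ≡ sumV (λ i → ι (+ c i) · Δ i)

  IsFundWeights : (Fin n → V n) → (Fin n → V n) → Set
  IsFundWeights Δ ω = ∀ i j → pair (ω i) (Δ j) ≡ δ i j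

  InP : (Fin n → V n) → V n → Set
  InP ω v = ∃ λ (c : Fin n → ℤ) → v ≡ sumV (λ i → ι (c i) · ω i)

  ρ : (Fin n → V n) → V n
  ρ ω = sumV ω

  IsHighestCoroot : List (V n) → (Fin n → V n) → V n → Set
  IsHighestCoroot Φ Δ θ = θ ∈ Φ × (∀ γ → γ ∈ Φ → ∃ λ (c : Fin n → ℕ) →
      coroot θ ⊖ coroot γ ≡ sumV (λ i → ι (+ c i) · coroot (Δ i)))

  coxeter : (Fin n → V n) → V n → ℚ
  coxeter ω θ = pair (ρ ω) θ + 1ℚ

  -- Weyl group: words in reflections s_α (α ∈ Φ)

  InW : List (V n) → List (V n) → Set
  InW Φ w = All (_∈ Φ) w

  act : List (V n) → V n → V n
  act w v = foldr reflect v w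

  InC : List (V n) → (Fin n → V n) → V n → List (V n) → Set
  InC Φ ω θ w = InW Φ w × ∃ λ μ → InP ω μ × (ρ ω ⊖ act w (ρ ω) ≡ coxeter ω θ · μ)

  -- k ∈ ℕ[Φ]^W  (k given as a function on V; only its values on Φ matter)
  IsWInvariant : List (V n) → (V n → ℕ) → Set
  IsWInvariant Φ k = ∀ w → InW Φ w → ∀ α → α ∈ Φ → k (act w α) ≡ k α

  symRel : List (V n) → (Fin n → V n) → (V n → ℕ) → V n → V n → Set
  symRel Φ Δ k l m = ∃ λ α → α ∈ Φ × IsPositive Δ α × m ≡ l ⊕ α ×
    ∃ λ (z : ℤ) → pair l α + 1ℚ ≡ ι z × ℤ.- (+ k α) ℤ.≤ z × z ℤ.≤ + k α

  trRel : List (V n) → (Fin n → V n) → (V n → ℕ) → V n → V n → Set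
  trRel Φ Δ k l m = ∃ λ α → α ∈ Φ × IsPositive Δ α × m ≡ l ⊕ α ×
    ∃ λ (z : ℤ) → pair l α + 1ℚ ≡ ι z × ℤ.- (+ k α) ℤ.+ + 1 ℤ.≤ z × z ℤ.≤ + k α

Undirected : ∀ {n} → (V n → V n → Set) → V n → V n → Set
Undirected R l m = R l m ⊎ R m l

IsAutomorphism : ∀ {n} → (V n → Set) → (V n → V n → Set) → (V n → V n) → Set
IsAutomorphism {n} Vert Adj f =
  (∀ l → Vert l → Vert (f l)) ×
  (∀ l m → Vert l → Vert m → f l ≡ f m → l ≡ m) ×
  (∀ m → Vert m → ∃ λ l → Vert l × f l ≡ m) ×
  (∀ l m → Vert l → Vert m → Adj l m ⇔ Adj (f l) (f m))

module Submission where

-- All vectors live in ℚⁿ with the symmetric bilinear form ⟪_,_⟫ of the Gram matrix M.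
-- 1. Reflections s_α are linear isometries with s_α ∘ s_α = id and (s_α β)^∨ = s_α(β^∨);
--    hence a Weyl word w preserves all pairings ⟨v, γ^∨⟩, permutes Φ and is undone by
--    the reversed word.
-- 2. Coroot integrality: ⟨ω_j, γ^∨⟩ ∈ ℤ for every root γ, by induction on the height of a
--    positive root, lowering it by a simple reflection.  Since Φ spans V and the form is
--    definite, the weight lattice P is {v | ⟨v, γ^∨⟩ ∈ ℤ for all γ ∈ Φ}, so W preserves P.
-- 3. Edge transport: w sends an edge λ → λ+α to w(λ) → w(λ)+w(α); if w(α) is negative the
--    edge is read backwards along -w(α).  W-invariance of k keeps the window condition.
-- 4. For w ∈ C the affine map is v ↦ w(v) + μ with hμ = ρ - w(ρ), μ ∈ P.  Since
--    1 ≤ ⟨ρ, γ^∨⟩ ≤ ⟨ρ, θ^∨⟩ = h - 1 for positive γ, the integer ⟨μ, w(α)^∨⟩ is 0 when w(α) is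
--    positive and -1 when it is negative; this is exactly the shift the truncated window absorbs.

open import Defs
open import Data.Nat as ℕ using (ℕ; zero; suc)
open import Data.Nat.Induction using (<-rec)
open import Data.Integer as ℤ using (ℤ; -[1+_])
import Data.Integer.Properties as ℤP
import Data.Integer.Solver as ℤSolver
open import Data.Rational as ℚ using (ℚ; mkℚ; 0ℚ; 1ℚ; _+_; _*_; _-_; -_; _<_; _≤_)
import Data.Rational.Properties as ℚP
import Data.Rational.Unnormalised as ℚᵘ
import Data.Rational.Unnormalised.Properties as ℚᵘP
open import Data.Rational.Solver using (module +-*-Solver)
import Data.Nat.Coprimality as Coprime
open import Data.Fin as Fin using (Fin)
open import Data.Vec using (lookup)
import Data.Vec.Properties as VecP
open import Data.List as List using (List; []; _∷_; _++_; reverse)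
import Data.List.Properties as ListP
open import Data.List.Relation.Unary.All using ([]; _∷_)
import Data.List.Relation.Unary.All.Properties as AllP
open import Data.List.Membership.Propositional using (_∈_)
open import Data.List.Membership.Propositional.Properties using (∈-lookup)
open import Data.Product using (∃; _×_; _,_; proj₁; proj₂)
open import Data.Sum using (_⊎_; inj₁; inj₂)
open import Data.Empty using (⊥-elim)
open import Relation.Nullary using (Dec; yes; no)
open import Relation.Binary.PropositionalEquality
open import Function using (_∘_)
open import Function.Bundles using (mk⇔; Equivalence)

open +-*-Solver

-- The embedding ι : ℤ → ℚ is an ordered ring homomorphism.  It is proved on unnormalised
-- rationals, where ι z is literally the fraction z/1.
module IntegerEmbedding where

  open ℚᵘP.≃-Reasoning

  ι≡mkℚ : ∀ z → ι z ≡ mkℚ z 0 (Coprime.sym (Coprime.1-coprimeTo ℤ.∣ z ∣))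
  ι≡mkℚ z = ℚP.↥p/↧p≡p (mkℚ z 0 (Coprime.sym (Coprime.1-coprimeTo ℤ.∣ z ∣)))

  ι≃ : ∀ z → ℚ.toℚᵘ (ι z) ℚᵘ.≃ ℚᵘ.mkℚᵘ z 0
  ι≃ z = ℚP.toℚᵘ-fromℚᵘ (ℚᵘ.mkℚᵘ z 0)

  ι-+ : ∀ a b → ι (a ℤ.+ b) ≡ ι a + ι b
  ι-+ a b = ℚP.toℚᵘ-injective (begin
    ℚ.toℚᵘ (ι (a ℤ.+ b))               ≈⟨ ι≃ (a ℤ.+ b) ⟩
    ℚᵘ.mkℚᵘ (a ℤ.+ b) 0                ≈⟨ ℚᵘ.*≡* cross ⟩
    ℚᵘ.mkℚᵘ a 0 ℚᵘ.+ ℚᵘ.mkℚᵘ b 0        ≈⟨ ℚᵘP.+-cong (ℚᵘP.≃-sym (ι≃ a)) (ℚᵘP.≃-sym (ι≃ b)) ⟩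
    ℚ.toℚᵘ (ι a) ℚᵘ.+ ℚ.toℚᵘ (ι b)      ≈⟨ ℚᵘP.≃-sym (ℚP.toℚᵘ-homo-+ (ι a) (ι b)) ⟩
    ℚ.toℚᵘ (ι a + ι b)                 ∎)
    where
    cross : (a ℤ.+ b) ℤ.* ℤ.+ 1 ≡ (a ℤ.* ℤ.+ 1 ℤ.+ b ℤ.* ℤ.+ 1) ℤ.* ℤ.+ 1
    cross rewrite ℤP.*-identityʳ (a ℤ.+ b) | ℤP.*-identityʳ a | ℤP.*-identityʳ b
                | ℤP.*-identityʳ (a ℤ.+ b) = refl

  ι-* : ∀ a b → ι (a ℤ.* b) ≡ ι a * ι b
  ι-* a b = ℚP.toℚᵘ-injective (begin
    ℚ.toℚᵘ (ι (a ℤ.* b))               ≈⟨ ι≃ (a ℤ.* b) ⟩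
    ℚᵘ.mkℚᵘ (a ℤ.* b) 0                ≈⟨ ℚᵘ.*≡* refl ⟩
    ℚᵘ.mkℚᵘ a 0 ℚᵘ.* ℚᵘ.mkℚᵘ b 0        ≈⟨ ℚᵘP.*-cong (ℚᵘP.≃-sym (ι≃ a)) (ℚᵘP.≃-sym (ι≃ b)) ⟩
    ℚ.toℚᵘ (ι a) ℚᵘ.* ℚ.toℚᵘ (ι b)      ≈⟨ ℚᵘP.≃-sym (ℚP.toℚᵘ-homo-* (ι a) (ι b)) ⟩
    ℚ.toℚᵘ (ι a * ι b)                 ∎)

  ι-neg : ∀ a → ι (ℤ.- a) ≡ - ι a
  ι-neg a = ℚP.toℚᵘ-injective (begin
    ℚ.toℚᵘ (ι (ℤ.- a))          ≈⟨ ι≃ (ℤ.- a) ⟩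
    ℚᵘ.mkℚᵘ (ℤ.- a) 0           ≈⟨ ℚᵘ.*≡* refl ⟩
    ℚᵘ.- ℚᵘ.mkℚᵘ a 0            ≈⟨ ℚᵘP.-‿cong (ℚᵘP.≃-sym (ι≃ a)) ⟩
    ℚᵘ.- ℚ.toℚᵘ (ι a)           ≈⟨ ℚᵘP.≃-sym (ℚP.toℚᵘ-homo‿- (ι a)) ⟩
    ℚ.toℚᵘ (- ι a)              ∎)

  ι-mono-≤ : ∀ a b → a ℤ.≤ b → ι a ≤ ι b
  ι-mono-≤ a b a≤b with ι a | ι≡mkℚ a | ι b | ι≡mkℚ b
  ... | _ | refl | _ | refl =
    ℚ.*≤* (subst₂ ℤ._≤_ (sym (ℤP.*-identityʳ a)) (sym (ℤP.*-identityʳ b)) a≤b)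

  ι-cancel-< : ∀ a b → ι a < ι b → a ℤ.< b
  ι-cancel-< a b ιa<ιb with ι a | ι≡mkℚ a | ι b | ι≡mkℚ b
  ι-cancel-< a b (ℚ.*<* a<b) | _ | refl | _ | refl
    rewrite ℤP.*-identityʳ a | ℤP.*-identityʳ b = a<b

  nonneg-ℤ : ∀ z → ℤ.+ 0 ℤ.≤ z → z ≡ ℤ.+ ℤ.∣ z ∣
  nonneg-ℤ (ℤ.+ m) _ = refl

  nonpos-ℤ : ∀ z → z ℤ.≤ ℤ.+ 0 → ℤ.- z ≡ ℤ.+ ℤ.∣ z ∣
  nonpos-ℤ (ℤ.+ 0)     _            = refl
  nonpos-ℤ -[1+ m ]    _            = refl
  nonpos-ℤ (ℤ.+ suc m) (ℤ.+≤+ ())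

  ι-nonneg : ∀ m → 0ℚ ≤ ι (ℤ.+ m)
  ι-nonneg m = ι-mono-≤ (ℤ.+ 0) (ℤ.+ m) (ℤ.+≤+ ℕ.z≤n)

open IntegerEmbedding

module Integrality where

  int+ : ∀ {p q} → IsInt p → IsInt q → IsInt (p + q)
  int+ (a , refl) (b , refl) = a ℤ.+ b , sym (ι-+ a b)

  int* : ∀ {p q} → IsInt p → IsInt q → IsInt (p * q)
  int* (a , refl) (b , refl) = a ℤ.* b , sym (ι-* a b)

  int-neg : ∀ {p} → IsInt p → IsInt (- p)
  int-neg (a , refl) = ℤ.- a , sym (ι-neg a)

  int- : ∀ {p q} → IsInt p → IsInt q → IsInt (p - q)
  int- ip iq = int+ ip (int-neg iq)

  int0 : IsInt 0ℚ
  int0 = ℤ.+ 0 , refl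

  int1 : IsInt 1ℚ
  int1 = ℤ.+ 1 , refl

  int-pos⇒≥1 : ∀ {q} → IsInt q → 0ℚ < q → 1ℚ ≤ q
  int-pos⇒≥1 (a , refl) p = ι-mono-≤ (ℤ.+ 1) a (ℤP.i<j⇒suc[i]≤j (ι-cancel-< (ℤ.+ 0) a p))

  int-between⇒0 : ∀ {q} → IsInt q → - 1ℚ < q → q < 1ℚ → q ≡ 0ℚ
  int-between⇒0 (a , refl) lo hi = only-zero a (ι-cancel-< -[1+ 0 ] a lo) (ι-cancel-< a (ℤ.+ 1) hi)
    where
    only-zero : ∀ a → -[1+ 0 ] ℤ.< a → a ℤ.< ℤ.+ 1 → ι a ≡ 0ℚ
    only-zero (ℤ.+ 0)      _ _                        = refl
    only-zero (ℤ.+ suc n)  _ (ℤ.+<+ (ℕ.s≤s ()))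
    only-zero -[1+ n ]   (ℤ.-<- ()) _

open Integrality

module RationalFacts where

  -- 2 = ⟨α, α^∨⟩, written so that the ring solver sees it as 1 + 1
  two : ℚ
  two = 1ℚ + 1ℚ

  0<two : 0ℚ < two
  0<two = ℚ.*<* (ℤ.+<+ (ℕ.s≤s ℕ.z≤n))

  inv-inverseˡ : ∀ q → q ≢ 0ℚ → inv q * q ≡ 1ℚ
  inv-inverseˡ q q≢0 with q ℚP.≟ 0ℚ
  ... | yes q≡0  = ⊥-elim (q≢0 q≡0)
  ... | no q≢0′  = ℚP.*-inverseˡ q {{ℚ.≢-nonZero q≢0′}}

  inv-pos : ∀ q → 0ℚ < q → 0ℚ < inv q
  inv-pos q 0<q with q ℚP.≟ 0ℚ
  ... | yes q≡0 = ⊥-elim (ℚP.<⇒≢ 0<q (sym q≡0))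
  ... | no _    = ℚP.positive⁻¹ _ {{ℚP.1/pos⇒pos q {{ℚ.positive 0<q}}}}

  pos⇒≢0 : ∀ {q} → 0ℚ < q → q ≢ 0ℚ
  pos⇒≢0 p q≡0 = ℚP.<-irrefl (sym q≡0) p

  *-pos : ∀ {a b} → 0ℚ < a → 0ℚ < b → 0ℚ < a * b
  *-pos {a} {b} p q = ℚP.positive⁻¹ _ {{ℚP.pos*pos⇒pos a {{ℚ.positive p}} b {{ℚ.positive q}}}}

  *-nonneg : ∀ {a b} → 0ℚ ≤ a → 0ℚ ≤ b → 0ℚ ≤ a * b
  *-nonneg {a} {b} p q =
    ℚP.nonNegative⁻¹ _ {{ℚP.nonNeg*nonNeg⇒nonNeg a {{ℚ.nonNegative p}} b {{ℚ.nonNegative q}}}}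

  *-nonpos : ∀ {a b} → 0ℚ ≤ a → b ≤ 0ℚ → a * b ≤ 0ℚ
  *-nonpos {a} {b} p q =
    ℚP.nonPositive⁻¹ _ {{ℚP.nonNeg*nonPos⇒nonPos a {{ℚ.nonNegative p}} b {{ℚ.nonPositive q}}}}

  *-pos-factors : ∀ {a b} → 0ℚ ≤ a → 0ℚ < a * b → 0ℚ < a × 0ℚ < b
  *-pos-factors {a} {b} 0≤a 0<ab = left (0ℚ ℚP.<? a) , right (0ℚ ℚP.<? b)
    where
    left : Dec (0ℚ < a) → 0ℚ < a
    left (yes p) = p
    left (no ¬p) = ⊥-elim (ℚP.<-irrefl (sym (trans (cong (_* b) a≡0) (ℚP.*-zeroˡ b))) 0<ab)
      where a≡0 = ℚP.≤-antisym (ℚP.≮⇒≥ ¬p) 0≤a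
    right : Dec (0ℚ < b) → 0ℚ < b
    right (yes p) = p
    right (no ¬p) = ⊥-elim (ℚP.<-irrefl refl (ℚP.<-≤-trans 0<ab (*-nonpos 0≤a (ℚP.≮⇒≥ ¬p))))

  *-cancel-pos : ∀ {a x} → 0ℚ < a → a * x ≡ 0ℚ → x ≡ 0ℚ
  *-cancel-pos {a} {x} p ax≡0 = begin
    x                  ≡⟨ sym (ℚP.*-identityˡ x) ⟩
    1ℚ * x             ≡⟨ cong (_* x) (sym (inv-inverseˡ a (pos⇒≢0 p))) ⟩
    (inv a * a) * x    ≡⟨ ℚP.*-assoc (inv a) a x ⟩
    inv a * (a * x)    ≡⟨ cong (inv a *_) ax≡0 ⟩
    inv a * 0ℚ         ≡⟨ ℚP.*-zeroʳ (inv a) ⟩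
    0ℚ                 ∎
    where open ≡-Reasoning

  a-b≡0⇒a≡b : ∀ {a b} → a - b ≡ 0ℚ → a ≡ b
  a-b≡0⇒a≡b {a} {b} e = begin
    a                 ≡⟨ solve 2 (λ a b → a := (a :- b) :+ b) refl a b ⟩
    (a - b) + b       ≡⟨ cong (_+ b) e ⟩
    0ℚ + b            ≡⟨ ℚP.+-identityˡ b ⟩
    b                 ∎
    where open ≡-Reasoning

  a-b<a : ∀ a b → 0ℚ < b → a - b < a
  a-b<a a b p = subst (a - b <_) (ℚP.+-identityʳ a) (ℚP.+-monoʳ-< a (ℚP.neg-antimono-< p))

  0≤b-a : ∀ {a b} → a ≤ b → 0ℚ ≤ b - a
  0≤b-a {a} {b} p = subst (_≤ b - a) (ℚP.+-inverseʳ a) (ℚP.+-monoˡ-≤ (- a) p)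

  0<b-a⇒a<b : ∀ {a b} → 0ℚ < b - a → a < b
  0<b-a⇒a<b {a} {b} p =
    subst₂ _<_ (ℚP.+-identityʳ a) (solve 2 (λ a b → a :+ (b :- a) := b) refl a b) (ℚP.+-monoʳ-< a p)

  0≤b-a⇒a≤b : ∀ {a b} → 0ℚ ≤ b - a → a ≤ b
  0≤b-a⇒a≤b {a} {b} p =
    subst₂ _≤_ (ℚP.+-identityʳ a) (solve 2 (λ a b → a :+ (b :- a) := b) refl a b) (ℚP.+-monoʳ-≤ a p)

open RationalFacts

module Coordinates where

  ext : ∀ {m} {u v : V m} → (∀ i → lookup u i ≡ lookup v i) → u ≡ v
  ext {u = u} {v} p =
    trans (sym (VecP.tabulate∘lookup u)) (trans (VecP.tabulate-cong p) (VecP.tabulate∘lookup v))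

  module _ {m : ℕ} where

    lookup-⊕ : ∀ (u v : V m) i → lookup (u ⊕ v) i ≡ lookup u i + lookup v i
    lookup-⊕ u v i = VecP.lookup-zipWith _+_ i u v

    lookup-⊖ : ∀ (u v : V m) i → lookup (u ⊖ v) i ≡ lookup u i - lookup v i
    lookup-⊖ u v i = VecP.lookup-zipWith _-_ i u v

    lookup-· : ∀ c (u : V m) i → lookup (c · u) i ≡ c * lookup u i
    lookup-· c u i = VecP.lookup-map i (c *_) u

    lookup-𝟎 : ∀ i → lookup (𝟎 {m}) i ≡ 0ℚ
    lookup-𝟎 i = VecP.lookup-replicate i 0ℚ

  module _ {m : ℕ} where

    neg : V m → V m
    neg v = (- 1ℚ) · v

    ⊖-self : ∀ (v : V m) → v ⊖ v ≡ 𝟎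
    ⊖-self v = ext λ k → trans (lookup-⊖ v v k) (trans (ℚP.+-inverseʳ (lookup v k)) (sym (lookup-𝟎 k)))

    ·-identity : ∀ (v : V m) → 1ℚ · v ≡ v
    ·-identity v = ext λ k → trans (lookup-· 1ℚ v k) (ℚP.*-identityˡ (lookup v k))

    ·-inverse : ∀ c (v : V m) → c ≢ 0ℚ → inv c · (c · v) ≡ v
    ·-inverse c v c≢0 = ext λ k → begin
      lookup (inv c · (c · v)) k   ≡⟨ trans (lookup-· (inv c) (c · v) k) (cong (inv c *_) (lookup-· c v k)) ⟩
      inv c * (c * lookup v k)     ≡⟨ sym (ℚP.*-assoc (inv c) c (lookup v k)) ⟩
      inv c * c * lookup v k       ≡⟨ cong (_* lookup v k) (inv-inverseˡ c c≢0) ⟩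
      1ℚ * lookup v k              ≡⟨ ℚP.*-identityˡ (lookup v k) ⟩
      lookup v k                   ∎
      where open ≡-Reasoning

    neg-involutive : ∀ (v : V m) → neg (neg v) ≡ v
    neg-involutive v = ext λ k → trans (lookup-· (- 1ℚ) (neg v) k)
      (trans (cong ((- 1ℚ) *_) (lookup-· (- 1ℚ) v k))
        (solve 1 (λ a → (:- con 1ℚ) :* ((:- con 1ℚ) :* a) := a) refl (lookup v k)))

    ⊕-neg-cancel : ∀ (x y : V m) → (x ⊕ y) ⊕ neg y ≡ x
    ⊕-neg-cancel x y = ext λ k → trans (lookup-⊕ (x ⊕ y) (neg y) k)
      (trans (cong₂ _+_ (lookup-⊕ x y k) (lookup-· (- 1ℚ) y k))
        (solve 2 (λ a b → (a :+ b) :+ (:- con 1ℚ) :* b := a) refl (lookup x k) (lookup y k)))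

    neg-⊕-cancel : ∀ (x y : V m) → (x ⊕ neg y) ⊕ y ≡ x
    neg-⊕-cancel x y = ext λ k → trans (lookup-⊕ (x ⊕ neg y) y k)
      (trans (cong (_+ lookup y k) (trans (lookup-⊕ x (neg y) k) (cong (lookup x k +_) (lookup-· (- 1ℚ) y k))))
        (solve 2 (λ a b → (a :+ (:- con 1ℚ) :* b) :+ b := a) refl (lookup x k) (lookup y k)))

    ·-neg : ∀ c (x : V m) → c · neg x ≡ neg (c · x)
    ·-neg c x = ext λ k → trans (lookup-· c (neg x) k) (trans (cong (c *_) (lookup-· (- 1ℚ) x k))
      (trans (solve 2 (λ c a → c :* ((:- con 1ℚ) :* a) := (:- con 1ℚ) :* (c :* a)) refl c (lookup x k))
        (sym (trans (lookup-· (- 1ℚ) (c · x) k) (cong ((- 1ℚ) *_) (lookup-· c x k))))))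

    neg-⊖ : ∀ (x y : V m) → neg (x ⊖ y) ≡ y ⊖ x
    neg-⊖ x y = ext λ k → trans (lookup-· (- 1ℚ) (x ⊖ y) k) (trans (cong ((- 1ℚ) *_) (lookup-⊖ x y k))
      (trans (solve 2 (λ a b → (:- con 1ℚ) :* (a :- b) := b :- a) refl (lookup x k) (lookup y k))
        (sym (lookup-⊖ y x k))))

    ⊕-swap : ∀ (a b c : V m) → (a ⊕ b) ⊕ c ≡ (a ⊕ c) ⊕ b
    ⊕-swap a b c = ext λ k → trans (lookup-⊕ (a ⊕ b) c k) (trans (cong (_+ lookup c k) (lookup-⊕ a b k))
      (sym (trans (lookup-⊕ (a ⊕ c) b k) (trans (cong (_+ lookup b k) (lookup-⊕ a c k))
        (solve 3 (λ x y z → (x :+ z) :+ y := (x :+ y) :+ z) refl (lookup a k) (lookup b k) (lookup c k))))))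

    ⊖-⊕-scaled : ∀ c (a b r : V m) → (a ⊖ c · b) ⊕ c · r ≡ a ⊕ c · (r ⊖ b)
    ⊖-⊕-scaled c a b r = ext coordinate
      where
      open ≡-Reasoning
      lookup-left : ∀ k → lookup (a ⊖ c · b) k ≡ lookup a k - c * lookup b k
      lookup-left k = trans (lookup-⊖ a (c · b) k) (cong (λ y → lookup a k - y) (lookup-· c b k))
      lookup-right : ∀ k → lookup (c · (r ⊖ b)) k ≡ c * (lookup r k - lookup b k)
      lookup-right k = trans (lookup-· c (r ⊖ b) k) (cong (c *_) (lookup-⊖ r b k))
      coordinate : ∀ k → lookup ((a ⊖ c · b) ⊕ c · r) k ≡ lookup (a ⊕ c · (r ⊖ b)) k
      coordinate k = begin
          lookup ((a ⊖ c · b) ⊕ c · r) k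
        ≡⟨ trans (lookup-⊕ (a ⊖ c · b) (c · r) k) (cong₂ _+_ (lookup-left k) (lookup-· c r k)) ⟩
          (lookup a k - c * lookup b k) + c * lookup r k
        ≡⟨ solve 4 (λ a c b r → (a :- c :* b) :+ c :* r := a :+ c :* (r :- b)) refl
             (lookup a k) c (lookup b k) (lookup r k) ⟩
          lookup a k + c * (lookup r k - lookup b k)
        ≡⟨ sym (trans (lookup-⊕ a (c · (r ⊖ b)) k) (cong (lookup a k +_) (lookup-right k))) ⟩
          lookup (a ⊕ c · (r ⊖ b)) k
        ∎

open Coordinates

module FiniteSums where

  sumQ-cong : ∀ {m} {f g : Fin m → ℚ} → (∀ i → f i ≡ g i) → sumQ f ≡ sumQ g
  sumQ-cong {zero}  p = refl
  sumQ-cong {suc m} p = cong₂ _+_ (p Fin.zero) (sumQ-cong (p ∘ Fin.suc))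

  sumQ-+ : ∀ {m} (f g : Fin m → ℚ) → sumQ (λ i → f i + g i) ≡ sumQ f + sumQ g
  sumQ-+ {zero}  f g = refl
  sumQ-+ {suc m} f g = trans (cong ((f Fin.zero + g Fin.zero) +_) (sumQ-+ (f ∘ Fin.suc) (g ∘ Fin.suc)))
    (solve 4 (λ a b c d → (a :+ b) :+ (c :+ d) := (a :+ c) :+ (b :+ d)) refl
       (f Fin.zero) (g Fin.zero) (sumQ (f ∘ Fin.suc)) (sumQ (g ∘ Fin.suc)))

  sumQ-- : ∀ {m} (f g : Fin m → ℚ) → sumQ (λ i → f i - g i) ≡ sumQ f - sumQ g
  sumQ-- {zero}  f g = refl
  sumQ-- {suc m} f g = trans (cong ((f Fin.zero - g Fin.zero) +_) (sumQ-- (f ∘ Fin.suc) (g ∘ Fin.suc)))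
    (solve 4 (λ a b c d → (a :- b) :+ (c :- d) := (a :+ c) :- (b :+ d)) refl
       (f Fin.zero) (g Fin.zero) (sumQ (f ∘ Fin.suc)) (sumQ (g ∘ Fin.suc)))

  sumQ-* : ∀ {m} c (f : Fin m → ℚ) → sumQ (λ i → c * f i) ≡ c * sumQ f
  sumQ-* {zero}  c f = sym (ℚP.*-zeroʳ c)
  sumQ-* {suc m} c f = trans (cong ((c * f Fin.zero) +_) (sumQ-* c (f ∘ Fin.suc)))
    (sym (ℚP.*-distribˡ-+ c (f Fin.zero) (sumQ (f ∘ Fin.suc))))

  sumQ-0 : ∀ {m} → sumQ {m} (λ _ → 0ℚ) ≡ 0ℚ
  sumQ-0 {zero}  = refl
  sumQ-0 {suc m} = cong (0ℚ +_) (sumQ-0 {m})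

  sumQ-swap : ∀ {m k} (f : Fin m → Fin k → ℚ) →
    sumQ (λ i → sumQ (λ j → f i j)) ≡ sumQ (λ j → sumQ (λ i → f i j))
  sumQ-swap {zero}  {k} f = sym (sumQ-0 {k})
  sumQ-swap {suc m}     f = trans (cong (sumQ (f Fin.zero) +_) (sumQ-swap (f ∘ Fin.suc)))
    (sym (sumQ-+ (f Fin.zero) (λ j → sumQ (λ i → f (Fin.suc i) j))))

  sumQ-vanish : ∀ {m} (f : Fin m → ℚ) → (∀ i → f i ≡ 0ℚ) → sumQ f ≡ 0ℚ
  sumQ-vanish {m} f p = trans (sumQ-cong p) (sumQ-0 {m})

  δ-diag : ∀ {m} (i : Fin m) → δ i i ≡ 1ℚ
  δ-diag i with i Fin.≟ i
  ... | yes _  = refl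
  ... | no i≢i = ⊥-elim (i≢i refl)

  δ-off : ∀ {m} {i j : Fin m} → i ≢ j → δ i j ≡ 0ℚ
  δ-off {i = i} {j} i≢j with i Fin.≟ j
  ... | yes i≡j = ⊥-elim (i≢j i≡j)
  ... | no _    = refl

  δ-sym : ∀ {m} (i j : Fin m) → δ i j ≡ δ j i
  δ-sym i j with i Fin.≟ j | j Fin.≟ i
  ... | yes _   | yes _   = refl
  ... | no _    | no _    = refl
  ... | yes i≡j | no j≢i  = ⊥-elim (j≢i (sym i≡j))
  ... | no i≢j  | yes j≡i = ⊥-elim (i≢j (sym j≡i))

  δ-suc : ∀ {m} (i j : Fin m) → δ (Fin.suc i) (Fin.suc j) ≡ δ i j
  δ-suc i j with i Fin.≟ j
  ... | yes _ = refl
  ... | no _  = refl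

  sumQ-δ : ∀ {m} (i : Fin m) (f : Fin m → ℚ) → sumQ (λ j → δ i j * f j) ≡ f i
  sumQ-δ {suc m} Fin.zero f =
    trans (cong₂ _+_ (ℚP.*-identityˡ (f Fin.zero))
                     (sumQ-vanish _ λ j → ℚP.*-zeroˡ (f (Fin.suc j))))
          (ℚP.+-identityʳ (f Fin.zero))
  sumQ-δ {suc m} (Fin.suc i) f =
    trans (cong₂ _+_ (ℚP.*-zeroˡ (f Fin.zero))
                     (trans (sumQ-cong λ j → cong (_* f (Fin.suc j)) (δ-suc i j)) (sumQ-δ i (f ∘ Fin.suc))))
          (ℚP.+-identityˡ (f (Fin.suc i)))

  sumQ-δʳ : ∀ {m} (i : Fin m) (f : Fin m → ℚ) → sumQ (λ j → f j * δ j i) ≡ f i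
  sumQ-δʳ i f = trans (sumQ-cong λ j → trans (ℚP.*-comm (f j) (δ j i)) (cong (_* f j) (δ-sym j i)))
                      (sumQ-δ i f)

  int-δ : ∀ {m} (i j : Fin m) → IsInt (δ i j)
  int-δ i j with i Fin.≟ j
  ... | yes _ = int1
  ... | no _  = int0

  int-sumQ : ∀ {m} (f : Fin m → ℚ) → (∀ i → IsInt (f i)) → IsInt (sumQ f)
  int-sumQ {zero}  f p = int0
  int-sumQ {suc m} f p = int+ (p Fin.zero) (int-sumQ (f ∘ Fin.suc) (p ∘ Fin.suc))

  sumQ-nonneg : ∀ {m} (f : Fin m → ℚ) → (∀ i → 0ℚ ≤ f i) → 0ℚ ≤ sumQ f
  sumQ-nonneg {zero}  f p = ℚP.≤-refl
  sumQ-nonneg {suc m} f p = ℚP.+-mono-≤ (p Fin.zero) (sumQ-nonneg (f ∘ Fin.suc) (p ∘ Fin.suc))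

  sumQ-pos : ∀ {m} (f : Fin m → ℚ) → (∀ i → 0ℚ ≤ f i) → ∀ i → 0ℚ < f i → 0ℚ < sumQ f
  sumQ-pos {suc m} f p Fin.zero    q = ℚP.+-mono-<-≤ q (sumQ-nonneg (f ∘ Fin.suc) (p ∘ Fin.suc))
  sumQ-pos {suc m} f p (Fin.suc i) q = ℚP.+-mono-≤-< (p Fin.zero) (sumQ-pos (f ∘ Fin.suc) (p ∘ Fin.suc) i q)

  sumQ-pos⇒∃ : ∀ {m} (f : Fin m → ℚ) → 0ℚ < sumQ f → ∃ λ i → 0ℚ < f i
  sumQ-pos⇒∃ {zero}  f p = ⊥-elim (ℚP.<-irrefl refl p)
  sumQ-pos⇒∃ {suc m} f p with 0ℚ ℚP.<? f Fin.zero
  ... | yes q = Fin.zero , q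
  ... | no ¬q with sumQ-pos⇒∃ (f ∘ Fin.suc) (tail-pos (0ℚ ℚP.<? sumQ (f ∘ Fin.suc)))
    where
    tail-pos : Dec (0ℚ < sumQ (f ∘ Fin.suc)) → 0ℚ < sumQ (f ∘ Fin.suc)
    tail-pos (yes r) = r
    tail-pos (no ¬r) =
      ⊥-elim (ℚP.<-irrefl refl (ℚP.<-≤-trans p (ℚP.+-mono-≤ (ℚP.≮⇒≥ ¬q) (ℚP.≮⇒≥ ¬r))))
  ... | i , r = Fin.suc i , r

  sumN : ∀ {m} → (Fin m → ℕ) → ℕ
  sumN {zero}  c = 0
  sumN {suc m} c = c Fin.zero ℕ.+ sumN (c ∘ Fin.suc)

  ι-sumN : ∀ {m} (c : Fin m → ℕ) → ι (ℤ.+ sumN c) ≡ sumQ (λ i → ι (ℤ.+ c i))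
  ι-sumN {zero}  c = refl
  ι-sumN {suc m} c = trans (ι-+ (ℤ.+ c Fin.zero) (ℤ.+ sumN (c ∘ Fin.suc)))
    (cong (ι (ℤ.+ c Fin.zero) +_) (ι-sumN (c ∘ Fin.suc)))

  lookup-sumV : ∀ {n m} (f : Fin m → V n) i → lookup (sumV f) i ≡ sumQ (λ j → lookup (f j) i)
  lookup-sumV {n} {zero}  f i = lookup-𝟎 i
  lookup-sumV {n} {suc m} f i = trans (lookup-⊕ (f Fin.zero) _ i)
    (cong (lookup (f Fin.zero) i +_) (lookup-sumV (f ∘ Fin.suc) i))

  sumV-cong : ∀ {n m} {f g : Fin m → V n} → (∀ i → f i ≡ g i) → sumV f ≡ sumV g
  sumV-cong {m = zero}  p = refl
  sumV-cong {m = suc m} p = cong₂ _⊕_ (p Fin.zero) (sumV-cong (p ∘ Fin.suc))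

open FiniteSums

module LinearCombination {n m : ℕ} (e : Fin m → V n) where

  comb : (Fin m → ℚ) → V n
  comb x = sumV (λ j → x j · e j)

  lookup-comb : ∀ x k → lookup (comb x) k ≡ sumQ (λ j → x j * lookup (e j) k)
  lookup-comb x k = trans (lookup-sumV (λ j → x j · e j) k) (sumQ-cong λ j → lookup-· (x j) (e j) k)

  comb-cong : ∀ {x y} → (∀ j → x j ≡ y j) → comb x ≡ comb y
  comb-cong p = sumV-cong λ j → cong (_· e j) (p j)

  comb-⊖ : ∀ x y → comb x ⊖ comb y ≡ comb (λ j → x j - y j)
  comb-⊖ x y = ext λ k → begin
      lookup (comb x ⊖ comb y) k
    ≡⟨ lookup-⊖ (comb x) (comb y) k ⟩
      lookup (comb x) k - lookup (comb y) k
    ≡⟨ cong₂ _-_ (lookup-comb x k) (lookup-comb y k) ⟩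
      sumQ (λ j → x j * lookup (e j) k) - sumQ (λ j → y j * lookup (e j) k)
    ≡⟨ sym (sumQ-- (λ j → x j * lookup (e j) k) (λ j → y j * lookup (e j) k)) ⟩
      sumQ (λ j → x j * lookup (e j) k - y j * lookup (e j) k)
    ≡⟨ sumQ-cong (λ j → sym (distrib (x j) (y j) (lookup (e j) k))) ⟩
      sumQ (λ j → (x j - y j) * lookup (e j) k)
    ≡⟨ sym (lookup-comb (λ j → x j - y j) k) ⟩
      lookup (comb (λ j → x j - y j)) k
    ∎
    where
    open ≡-Reasoning
    distrib : ∀ a b c → (a - b) * c ≡ a * c - b * c
    distrib = solve 3 (λ a b c → (a :- b) :* c := a :* c :- b :* c) refl

  comb-· : ∀ a x → a · comb x ≡ comb (λ j → a * x j)
  comb-· a x = ext λ k → begin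
      lookup (a · comb x) k
    ≡⟨ lookup-· a (comb x) k ⟩
      a * lookup (comb x) k
    ≡⟨ cong (a *_) (lookup-comb x k) ⟩
      a * sumQ (λ j → x j * lookup (e j) k)
    ≡⟨ sym (sumQ-* a (λ j → x j * lookup (e j) k)) ⟩
      sumQ (λ j → a * (x j * lookup (e j) k))
    ≡⟨ sumQ-cong (λ j → sym (ℚP.*-assoc a (x j) (lookup (e j) k))) ⟩
      sumQ (λ j → a * x j * lookup (e j) k)
    ≡⟨ sym (lookup-comb (λ j → a * x j) k) ⟩
      lookup (comb (λ j → a * x j)) k
    ∎
    where open ≡-Reasoning

  comb-δ : ∀ a i → a · e i ≡ comb (λ j → δ i j * a)
  comb-δ a i = ext λ k → sym (begin
      lookup (comb (λ j → δ i j * a)) k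
    ≡⟨ lookup-comb (λ j → δ i j * a) k ⟩
      sumQ (λ j → δ i j * a * lookup (e j) k)
    ≡⟨ sumQ-cong (λ j → ℚP.*-assoc (δ i j) a (lookup (e j) k)) ⟩
      sumQ (λ j → δ i j * (a * lookup (e j) k))
    ≡⟨ sumQ-δ i (λ j → a * lookup (e j) k) ⟩
      a * lookup (e i) k
    ≡⟨ sym (lookup-· a (e i) k) ⟩
      lookup (a · e i) k
    ∎)
    where open ≡-Reasoning

module FormGeometry {n : ℕ} (M : Form n) (M-sym : ∀ i j → M i j ≡ M j i) where

  ⟨_,_⟩ : V n → V n → ℚ
  ⟨ u , v ⟩ = ⟪_,_⟫ M u v

  row : V n → Fin n → ℚ
  row x i = sumQ (λ j → M i j * lookup x j)

  form-by-rows : ∀ u x → ⟨ u , x ⟩ ≡ sumQ (λ i → lookup u i * row x i)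
  form-by-rows u x = sumQ-cong λ i →
    trans (sumQ-cong λ j → ℚP.*-assoc (lookup u i) (M i j) (lookup x j))
          (sumQ-* (lookup u i) (λ j → M i j * lookup x j))

  form-⊕ˡ : ∀ u v x → ⟨ u ⊕ v , x ⟩ ≡ ⟨ u , x ⟩ + ⟨ v , x ⟩
  form-⊕ˡ u v x = begin
      ⟨ u ⊕ v , x ⟩
    ≡⟨ form-by-rows (u ⊕ v) x ⟩
      sumQ (λ i → lookup (u ⊕ v) i * row x i)
    ≡⟨ sumQ-cong split ⟩
      sumQ (λ i → lookup u i * row x i + lookup v i * row x i)
    ≡⟨ sumQ-+ (λ i → lookup u i * row x i) (λ i → lookup v i * row x i) ⟩
      sumQ (λ i → lookup u i * row x i) + sumQ (λ i → lookup v i * row x i)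
    ≡⟨ sym (cong₂ _+_ (form-by-rows u x) (form-by-rows v x)) ⟩
      ⟨ u , x ⟩ + ⟨ v , x ⟩
    ∎
    where
    open ≡-Reasoning
    split : ∀ i → lookup (u ⊕ v) i * row x i ≡ lookup u i * row x i + lookup v i * row x i
    split i = trans (cong (_* row x i) (lookup-⊕ u v i)) (ℚP.*-distribʳ-+ (row x i) (lookup u i) (lookup v i))

  form-⊖ˡ : ∀ u v x → ⟨ u ⊖ v , x ⟩ ≡ ⟨ u , x ⟩ - ⟨ v , x ⟩
  form-⊖ˡ u v x = begin
      ⟨ u ⊖ v , x ⟩
    ≡⟨ form-by-rows (u ⊖ v) x ⟩
      sumQ (λ i → lookup (u ⊖ v) i * row x i)
    ≡⟨ sumQ-cong split ⟩
      sumQ (λ i → lookup u i * row x i - lookup v i * row x i)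
    ≡⟨ sumQ-- (λ i → lookup u i * row x i) (λ i → lookup v i * row x i) ⟩
      sumQ (λ i → lookup u i * row x i) - sumQ (λ i → lookup v i * row x i)
    ≡⟨ sym (cong₂ _-_ (form-by-rows u x) (form-by-rows v x)) ⟩
      ⟨ u , x ⟩ - ⟨ v , x ⟩
    ∎
    where
    open ≡-Reasoning
    split : ∀ i → lookup (u ⊖ v) i * row x i ≡ lookup u i * row x i - lookup v i * row x i
    split i = trans (cong (_* row x i) (lookup-⊖ u v i))
      (solve 3 (λ a b r → (a :- b) :* r := a :* r :- b :* r) refl (lookup u i) (lookup v i) (row x i))

  form-·ˡ : ∀ c u x → ⟨ c · u , x ⟩ ≡ c * ⟨ u , x ⟩
  form-·ˡ c u x = begin
      ⟨ c · u , x ⟩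
    ≡⟨ form-by-rows (c · u) x ⟩
      sumQ (λ i → lookup (c · u) i * row x i)
    ≡⟨ sumQ-cong (λ i → trans (cong (_* row x i) (lookup-· c u i)) (ℚP.*-assoc c (lookup u i) (row x i))) ⟩
      sumQ (λ i → c * (lookup u i * row x i))
    ≡⟨ sumQ-* c (λ i → lookup u i * row x i) ⟩
      c * sumQ (λ i → lookup u i * row x i)
    ≡⟨ cong (c *_) (sym (form-by-rows u x)) ⟩
      c * ⟨ u , x ⟩
    ∎
    where open ≡-Reasoning

  form-𝟎ˡ : ∀ x → ⟨ 𝟎 , x ⟩ ≡ 0ℚ
  form-𝟎ˡ x = trans (form-by-rows 𝟎 x)
    (sumQ-vanish _ λ i → trans (cong (_* row x i) (lookup-𝟎 i)) (ℚP.*-zeroˡ (row x i)))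

  form-sym : ∀ u v → ⟨ u , v ⟩ ≡ ⟨ v , u ⟩
  form-sym u v = trans (sumQ-swap (λ i j → lookup u i * M i j * lookup v j)) (sumQ-cong λ i → sumQ-cong λ j →
    trans (cong (λ m → lookup u j * m * lookup v i) (M-sym j i))
          (solve 3 (λ a b c → a :* b :* c := c :* b :* a) refl (lookup u j) (M i j) (lookup v i)))

  form-sumVˡ : ∀ {m} (f : Fin m → V n) x → ⟨ sumV f , x ⟩ ≡ sumQ (λ i → ⟨ f i , x ⟩)
  form-sumVˡ {zero}  f x = form-𝟎ˡ x
  form-sumVˡ {suc m} f x = trans (form-⊕ˡ (f Fin.zero) (sumV (f ∘ Fin.suc)) x)
    (cong (⟨ f Fin.zero , x ⟩ +_) (form-sumVˡ (f ∘ Fin.suc) x))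

  form-·ʳ : ∀ x c u → ⟨ x , c · u ⟩ ≡ c * ⟨ x , u ⟩
  form-·ʳ x c u = trans (form-sym x (c · u)) (trans (form-·ˡ c u x) (cong (c *_) (form-sym u x)))

  form-⊖ʳ : ∀ x u v → ⟨ x , u ⊖ v ⟩ ≡ ⟨ x , u ⟩ - ⟨ x , v ⟩
  form-⊖ʳ x u v = trans (form-sym x (u ⊖ v)) (trans (form-⊖ˡ u v x) (cong₂ _-_ (form-sym u x) (form-sym v x)))

  form-sumVʳ : ∀ {m} x (f : Fin m → V n) → ⟨ x , sumV f ⟩ ≡ sumQ (λ i → ⟨ x , f i ⟩)
  form-sumVʳ x f = trans (form-sym x (sumV f)) (trans (form-sumVˡ f x) (sumQ-cong λ i → form-sym (f i) x))

  form-combˡ : ∀ {m} (e : Fin m → V n) x y →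
    ⟨ LinearCombination.comb e x , y ⟩ ≡ sumQ (λ i → x i * ⟨ e i , y ⟩)
  form-combˡ e x y = trans (form-sumVˡ (λ i → x i · e i) y) (sumQ-cong λ i → form-·ˡ (x i) (e i) y)

  form-combʳ : ∀ {m} (e : Fin m → V n) x y →
    ⟨ y , LinearCombination.comb e x ⟩ ≡ sumQ (λ i → x i * ⟨ y , e i ⟩)
  form-combʳ e x y = trans (form-sumVʳ y (λ i → x i · e i)) (sumQ-cong λ i → form-·ʳ y (x i) (e i))

  NonIsotropic : V n → Set
  NonIsotropic α = ⟨ α , α ⟩ ≢ 0ℚ

  scale : V n → ℚ
  scale α = ι (ℤ.+ 2) * inv ⟨ α , α ⟩

  ⟨_,_⟩∨ : V n → V n → ℚ
  ⟨ v , α ⟩∨ = pair M v α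

  s : V n → V n → V n
  s = reflect M

  scale-norm : ∀ α → NonIsotropic α → scale α * ⟨ α , α ⟩ ≡ two
  scale-norm α nonIso = trans (ℚP.*-assoc two (inv ⟨ α , α ⟩) ⟨ α , α ⟩)
    (trans (cong (two *_) (inv-inverseˡ _ nonIso)) (ℚP.*-identityʳ two))

  pair-by-scale : ∀ v α → ⟨ v , α ⟩∨ ≡ scale α * ⟨ v , α ⟩
  pair-by-scale v α = form-·ʳ v (scale α) α

  pair-self : ∀ α → NonIsotropic α → ⟨ α , α ⟩∨ ≡ two
  pair-self α nonIso = trans (pair-by-scale α α) (scale-norm α nonIso)

  pair-⊕ : ∀ u v α → ⟨ u ⊕ v , α ⟩∨ ≡ ⟨ u , α ⟩∨ + ⟨ v , α ⟩∨
  pair-⊕ u v α = form-⊕ˡ u v (coroot M α)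

  pair-⊖ : ∀ u v α → ⟨ u ⊖ v , α ⟩∨ ≡ ⟨ u , α ⟩∨ - ⟨ v , α ⟩∨
  pair-⊖ u v α = form-⊖ˡ u v (coroot M α)

  pair-· : ∀ c u α → ⟨ c · u , α ⟩∨ ≡ c * ⟨ u , α ⟩∨
  pair-· c u α = form-·ˡ c u (coroot M α)

  pair-sumV : ∀ {m} (f : Fin m → V n) α → ⟨ sumV f , α ⟩∨ ≡ sumQ (λ i → ⟨ f i , α ⟩∨)
  pair-sumV f α = form-sumVˡ f (coroot M α)

  lookup-s : ∀ α v i → lookup (s α v) i ≡ lookup v i - ⟨ v , α ⟩∨ * lookup α i
  lookup-s α v i = trans (lookup-⊖ v _ i) (cong (λ y → lookup v i - y) (lookup-· ⟨ v , α ⟩∨ α i))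

  s-⊕ : ∀ α u v → s α (u ⊕ v) ≡ s α u ⊕ s α v
  s-⊕ α u v = ext λ i → trans (lookup-s α (u ⊕ v) i) (trans
    (cong₂ (λ a b → a - b * lookup α i) (lookup-⊕ u v i) (pair-⊕ u v α))
    (sym (trans (lookup-⊕ (s α u) (s α v) i) (trans (cong₂ _+_ (lookup-s α u i) (lookup-s α v i))
      (solve 5 (λ a b c d e → (a :- c :* e) :+ (b :- d :* e) := (a :+ b) :- (c :+ d) :* e) refl
        (lookup u i) (lookup v i) ⟨ u , α ⟩∨ ⟨ v , α ⟩∨ (lookup α i))))))

  s-⊖ : ∀ α u v → s α (u ⊖ v) ≡ s α u ⊖ s α v
  s-⊖ α u v = ext λ i → trans (lookup-s α (u ⊖ v) i) (trans
    (cong₂ (λ a b → a - b * lookup α i) (lookup-⊖ u v i) (pair-⊖ u v α))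
    (sym (trans (lookup-⊖ (s α u) (s α v) i) (trans (cong₂ _-_ (lookup-s α u i) (lookup-s α v i))
      (solve 5 (λ a b c d e → (a :- c :* e) :- (b :- d :* e) := (a :- b) :- (c :- d) :* e) refl
        (lookup u i) (lookup v i) ⟨ u , α ⟩∨ ⟨ v , α ⟩∨ (lookup α i))))))

  s-· : ∀ α c u → s α (c · u) ≡ c · s α u
  s-· α c u = ext λ i → trans (lookup-s α (c · u) i) (trans
    (cong₂ (λ a b → a - b * lookup α i) (lookup-· c u i) (pair-· c u α))
    (sym (trans (lookup-· c (s α u) i) (trans (cong (c *_) (lookup-s α u i))
      (solve 4 (λ c a p e → c :* (a :- p :* e) := c :* a :- c :* p :* e) refl
        c (lookup u i) ⟨ u , α ⟩∨ (lookup α i))))))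

  pair-s-self : ∀ α v → NonIsotropic α → ⟨ s α v , α ⟩∨ ≡ - ⟨ v , α ⟩∨
  pair-s-self α v nonIso = begin
      ⟨ s α v , α ⟩∨
    ≡⟨ pair-⊖ v _ α ⟩
      ⟨ v , α ⟩∨ - ⟨ ⟨ v , α ⟩∨ · α , α ⟩∨
    ≡⟨ cong (λ y → ⟨ v , α ⟩∨ - y) (pair-· ⟨ v , α ⟩∨ α α) ⟩
      ⟨ v , α ⟩∨ - ⟨ v , α ⟩∨ * ⟨ α , α ⟩∨
    ≡⟨ cong (λ x → ⟨ v , α ⟩∨ - ⟨ v , α ⟩∨ * x) (pair-self α nonIso) ⟩
      ⟨ v , α ⟩∨ - ⟨ v , α ⟩∨ * two
    ≡⟨ solve 1 (λ p → p :- p :* (con 1ℚ :+ con 1ℚ) := :- p) refl ⟨ v , α ⟩∨ ⟩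
      - ⟨ v , α ⟩∨
    ∎
    where open ≡-Reasoning

  s-involutive : ∀ α v → NonIsotropic α → s α (s α v) ≡ v
  s-involutive α v nonIso = ext λ i → trans (lookup-s α (s α v) i) (trans
    (cong₂ (λ a b → a - b * lookup α i) (lookup-s α v i) (pair-s-self α v nonIso))
    (solve 3 (λ a p e → (a :- p :* e) :- (:- p) :* e := a) refl (lookup v i) ⟨ v , α ⟩∨ (lookup α i)))

  s-self : ∀ α → NonIsotropic α → s α α ≡ neg α
  s-self α nonIso = ext λ i → trans (lookup-s α α i) (trans
    (cong (λ b → lookup α i - b * lookup α i) (pair-self α nonIso))
    (sym (trans (lookup-· (- 1ℚ) α i)
      (solve 1 (λ a → (:- con 1ℚ) :* a := a :- (con 1ℚ :+ con 1ℚ) :* a) refl (lookup α i)))))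

  -- s_α is an isometry: writing t = scale α, the cross terms of ⟨u - t⟨u,α⟩α, v - t⟨v,α⟩α⟩
  -- sum to t⟨u,α⟩⟨v,α⟩(t⟨α,α⟩ - 2) = 0
  s-isometry : ∀ α u v → NonIsotropic α → ⟨ s α u , s α v ⟩ ≡ ⟨ u , v ⟩
  s-isometry α u v nonIso = begin
      ⟨ s α u , s α v ⟩
    ≡⟨ form-⊖ˡ u (⟨ u , α ⟩∨ · α) (s α v) ⟩
      ⟨ u , s α v ⟩ - ⟨ ⟨ u , α ⟩∨ · α , s α v ⟩
    ≡⟨ cong₂ _-_ (form-⊖ʳ u v (⟨ v , α ⟩∨ · α)) (form-·ˡ ⟨ u , α ⟩∨ α (s α v)) ⟩
      (X - ⟨ u , ⟨ v , α ⟩∨ · α ⟩) - ⟨ u , α ⟩∨ * ⟨ α , s α v ⟩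
    ≡⟨ cong₂ (λ x y → (X - x) - ⟨ u , α ⟩∨ * y) (form-·ʳ u ⟨ v , α ⟩∨ α)
             (trans (form-⊖ʳ α v (⟨ v , α ⟩∨ · α)) (cong₂ _-_ (form-sym α v) (form-·ʳ α ⟨ v , α ⟩∨ α))) ⟩
      (X - ⟨ v , α ⟩∨ * A) - ⟨ u , α ⟩∨ * (B - ⟨ v , α ⟩∨ * N)
    ≡⟨ cong₂ (λ b a → (X - b * A) - a * (B - b * N)) (pair-by-scale v α) (pair-by-scale u α) ⟩
      (X - (t * B) * A) - (t * A) * (B - (t * B) * N)
    ≡⟨ solve 5 (λ X T A B N → (X :- (T :* B) :* A) :- (T :* A) :* (B :- (T :* B) :* N)
                              := X :+ T :* A :* B :* (T :* N :- (con 1ℚ :+ con 1ℚ))) refl X t A B N ⟩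
      X + t * A * B * (t * N - two)
    ≡⟨ cong (λ y → X + t * A * B * (y - two)) (scale-norm α nonIso) ⟩
      X + t * A * B * (two - two)
    ≡⟨ solve 4 (λ X T A B → X :+ T :* A :* B :* ((con 1ℚ :+ con 1ℚ) :- (con 1ℚ :+ con 1ℚ)) := X) refl X t A B ⟩
      X
    ∎
    where
    open ≡-Reasoning
    X = ⟨ u , v ⟩
    A = ⟨ u , α ⟩
    B = ⟨ v , α ⟩
    N = ⟨ α , α ⟩
    t = scale α

  coroot-s : ∀ α u → NonIsotropic α → coroot M (s α u) ≡ s α (coroot M u)
  coroot-s α u nonIso =
    trans (cong (λ x → (ι (ℤ.+ 2) * inv x) · s α u) (s-isometry α u u nonIso)) (sym (s-· α (scale u) u))

  pair-s : ∀ α v u → NonIsotropic α → ⟨ s α v , s α u ⟩∨ ≡ ⟨ v , u ⟩∨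
  pair-s α v u nonIso = trans (cong ⟨ s α v ,_⟩ (coroot-s α u nonIso)) (s-isometry α v (coroot M u) nonIso)

  pair-neg : ∀ v α → ⟨ v , neg α ⟩∨ ≡ - ⟨ v , α ⟩∨
  pair-neg v α = begin
      ⟨ v , neg α ⟩∨
    ≡⟨ pair-by-scale v (neg α) ⟩
      scale (neg α) * ⟨ v , neg α ⟩
    ≡⟨ cong₂ _*_ (cong (λ x → ι (ℤ.+ 2) * inv x) norm-neg) (form-·ʳ v (- 1ℚ) α) ⟩
      scale α * ((- 1ℚ) * ⟨ v , α ⟩)
    ≡⟨ solve 2 (λ T x → T :* ((:- con 1ℚ) :* x) := :- (T :* x)) refl (scale α) ⟨ v , α ⟩ ⟩
      - (scale α * ⟨ v , α ⟩)
    ≡⟨ cong -_ (sym (pair-by-scale v α)) ⟩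
      - ⟨ v , α ⟩∨
    ∎
    where
    open ≡-Reasoning
    norm-neg : ⟨ neg α , neg α ⟩ ≡ ⟨ α , α ⟩
    norm-neg = trans (form-·ˡ (- 1ℚ) α (neg α)) (trans (cong ((- 1ℚ) *_) (form-·ʳ α (- 1ℚ) α))
      (solve 1 (λ x → (:- con 1ℚ) :* ((:- con 1ℚ) :* x) := x) refl ⟨ α , α ⟩))

  -- an edge λ → λ+γ read backwards along -γ: the shifted pairing with -γ flips sign
  pair-reversed : ∀ x γ → NonIsotropic γ → ⟨ x ⊕ γ , neg γ ⟩∨ + 1ℚ ≡ - (⟨ x , γ ⟩∨ + 1ℚ)
  pair-reversed x γ nonIso = begin
      ⟨ x ⊕ γ , neg γ ⟩∨ + 1ℚ
    ≡⟨ cong (_+ 1ℚ) (pair-neg (x ⊕ γ) γ) ⟩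
      - ⟨ x ⊕ γ , γ ⟩∨ + 1ℚ
    ≡⟨ cong (λ p → - p + 1ℚ) (pair-⊕ x γ γ) ⟩
      - (⟨ x , γ ⟩∨ + ⟨ γ , γ ⟩∨) + 1ℚ
    ≡⟨ cong (λ p → - (⟨ x , γ ⟩∨ + p) + 1ℚ) (pair-self γ nonIso) ⟩
      - (⟨ x , γ ⟩∨ + two) + 1ℚ
    ≡⟨ solve 1 (λ p → :- (p :+ (con 1ℚ :+ con 1ℚ)) :+ con 1ℚ := :- (p :+ con 1ℚ)) refl ⟨ x , γ ⟩∨ ⟩
      - (⟨ x , γ ⟩∨ + 1ℚ)
    ∎
    where open ≡-Reasoning

module WeylWords {n : ℕ} (M : Form n) (M-sym : ∀ i j → M i j ≡ M j i) (Φ : List (V n))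
  (nonIso : ∀ α → α ∈ Φ → FormGeometry.NonIsotropic M M-sym α)
  (closed : ∀ α β → α ∈ Φ → β ∈ Φ → reflect M α β ∈ Φ) where

  open FormGeometry M M-sym

  infixr 8 _⊳_
  _⊳_ : List (V n) → V n → V n
  w ⊳ v = act M w v

  IsWord : List (V n) → Set
  IsWord = InW M Φ

  ⊳-⊕ : ∀ w u v → w ⊳ (u ⊕ v) ≡ w ⊳ u ⊕ w ⊳ v
  ⊳-⊕ []      u v = refl
  ⊳-⊕ (a ∷ w) u v = trans (cong (s a) (⊳-⊕ w u v)) (s-⊕ a _ _)

  ⊳-⊖ : ∀ w u v → w ⊳ (u ⊖ v) ≡ w ⊳ u ⊖ w ⊳ v
  ⊳-⊖ []      u v = refl
  ⊳-⊖ (a ∷ w) u v = trans (cong (s a) (⊳-⊖ w u v)) (s-⊖ a _ _)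

  ⊳-· : ∀ w c u → w ⊳ (c · u) ≡ c · (w ⊳ u)
  ⊳-· []      c u = refl
  ⊳-· (a ∷ w) c u = trans (cong (s a) (⊳-· w c u)) (s-· a c _)

  ⊳-pair : ∀ w → IsWord w → ∀ v u → ⟨ w ⊳ v , w ⊳ u ⟩∨ ≡ ⟨ v , u ⟩∨
  ⊳-pair []      _          v u = refl
  ⊳-pair (a ∷ w) (a∈ ∷ ws) v u = trans (pair-s a (w ⊳ v) (w ⊳ u) (nonIso a a∈)) (⊳-pair w ws v u)

  ⊳-root : ∀ w → IsWord w → ∀ α → α ∈ Φ → w ⊳ α ∈ Φ
  ⊳-root []      _          α α∈ = α∈
  ⊳-root (a ∷ w) (a∈ ∷ ws) α α∈ = closed a _ a∈ (⊳-root w ws α α∈)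

  ⊳-++ : ∀ w u v → (w ++ u) ⊳ v ≡ w ⊳ u ⊳ v
  ⊳-++ w u v = ListP.foldr-++ (reflect M) v w u

  reverse-word : ∀ w → IsWord w → IsWord (reverse w)
  reverse-word []      _          = []
  reverse-word (a ∷ w) (a∈ ∷ ws) =
    subst IsWord (sym (ListP.unfold-reverse a w)) (AllP.++⁺ (reverse-word w ws) (a∈ ∷ []))

  reverse-⊳ˡ : ∀ w → IsWord w → ∀ v → reverse w ⊳ w ⊳ v ≡ v
  reverse-⊳ˡ []      _          v = refl
  reverse-⊳ˡ (a ∷ w) (a∈ ∷ ws) v = begin
    reverse (a ∷ w) ⊳ s a (w ⊳ v)          ≡⟨ cong (_⊳ s a (w ⊳ v)) (ListP.unfold-reverse a w) ⟩
    (reverse w ++ a ∷ []) ⊳ s a (w ⊳ v)    ≡⟨ ⊳-++ (reverse w) (a ∷ []) (s a (w ⊳ v)) ⟩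
    reverse w ⊳ s a (s a (w ⊳ v))          ≡⟨ cong (reverse w ⊳_) (s-involutive a (w ⊳ v) (nonIso a a∈)) ⟩
    reverse w ⊳ w ⊳ v                      ≡⟨ reverse-⊳ˡ w ws v ⟩
    v                                      ∎
    where open ≡-Reasoning

  reverse-⊳ʳ : ∀ w → IsWord w → ∀ v → w ⊳ reverse w ⊳ v ≡ v
  reverse-⊳ʳ []      _          v = refl
  reverse-⊳ʳ (a ∷ w) (a∈ ∷ ws) v = begin
    s a (w ⊳ reverse (a ∷ w) ⊳ v)          ≡⟨ cong (λ u → s a (w ⊳ u ⊳ v)) (ListP.unfold-reverse a w) ⟩
    s a (w ⊳ (reverse w ++ a ∷ []) ⊳ v)    ≡⟨ cong (λ x → s a (w ⊳ x)) (⊳-++ (reverse w) (a ∷ []) v) ⟩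
    s a (w ⊳ reverse w ⊳ s a v)            ≡⟨ cong (s a) (reverse-⊳ʳ w ws (s a v)) ⟩
    s a (s a v)                            ≡⟨ s-involutive a v (nonIso a a∈) ⟩
    v                                      ∎
    where open ≡-Reasoning

automorphism-from-inverse : ∀ {n} (Vert : V n → Set) (Adj : V n → V n → Set) (F G : V n → V n) →
  (∀ l → Vert l → Vert (F l)) → (∀ l → Vert l → Vert (G l)) →
  (∀ l → G (F l) ≡ l) → (∀ m → F (G m) ≡ m) →
  (∀ l m → Adj l m → Adj (F l) (F m)) → (∀ l m → Adj l m → Adj (G l) (G m)) →
  IsAutomorphism Vert Adj F
automorphism-from-inverse Vert Adj F G F-vert G-vert GF FG F-adj G-adj =
  F-vert ,
  (λ l m _ _ Fl≡Fm → trans (sym (GF l)) (trans (cong G Fl≡Fm) (GF m))) ,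
  (λ m m-vert → G m , G-vert m m-vert , FG m) ,
  (λ l m _ _ → mk⇔ (F-adj l m) (λ adj → subst₂ Adj (GF l) (GF m) (G-adj (F l) (F m) adj)))

automorphism-cong : ∀ {n} (Vert : V n → Set) (Adj : V n → V n → Set) (F F′ : V n → V n) →
  (∀ v → F v ≡ F′ v) → IsAutomorphism Vert Adj F → IsAutomorphism Vert Adj F′
automorphism-cong Vert Adj F F′ F≗F′ (vert , inj , surj , adj) =
  (λ l l-vert → subst Vert (F≗F′ l) (vert l l-vert)) ,
  (λ l m l-vert m-vert e → inj l m l-vert m-vert (trans (F≗F′ l) (trans e (sym (F≗F′ m))))) ,
  (λ m m-vert → let (l , l-vert , Fl≡m) = surj m m-vert in l , l-vert , trans (sym (F≗F′ l)) Fl≡m) ,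
  (λ l m l-vert m-vert → let open Equivalence (adj l m l-vert m-vert) in
     mk⇔ (λ a → subst₂ Adj (F≗F′ l) (F≗F′ m) (to a))
         (λ a → from (subst₂ Adj (sym (F≗F′ l)) (sym (F≗F′ m)) a)))

undirected-preserved : ∀ {n} (R : V n → V n → Set) (F : V n → V n) →
  (∀ l m → R l m → Undirected R (F l) (F m)) → ∀ l m → Undirected R l m → Undirected R (F l) (F m)
undirected-preserved R F F-edge l m (inj₁ r) = F-edge l m r
undirected-preserved R F F-edge l m (inj₂ r) with F-edge m l r
... | inj₁ r′ = inj₂ r′
... | inj₂ r′ = inj₁ r′

-- The window {-k, …, k} of the symmetric relation and its truncation {-k+1, …, k}; the first is
-- closed under z ↦ -z, the second under z ↦ 1 - z.  These flips occur when an edge is reversed.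
SymWindow : ℕ → ℤ → Set
SymWindow k z = ℤ.- (ℤ.+ k) ℤ.≤ z × z ℤ.≤ ℤ.+ k

TrWindow : ℕ → ℤ → Set
TrWindow k z = ℤ.- (ℤ.+ k) ℤ.+ ℤ.+ 1 ℤ.≤ z × z ℤ.≤ ℤ.+ k

sym-window-flip : ∀ k z → SymWindow k z → SymWindow k (ℤ.- z)
sym-window-flip k z (lo , hi) =
  ℤP.neg-mono-≤ hi , subst (ℤ.- z ℤ.≤_) (ℤP.neg-involutive (ℤ.+ k)) (ℤP.neg-mono-≤ lo)

tr-window-flip : ∀ k z → TrWindow k z → TrWindow k (ℤ.+ 1 ℤ.+ ℤ.- z)
tr-window-flip k z (lo , hi) =
  subst (ℤ._≤ ℤ.+ 1 ℤ.+ ℤ.- z) (ℤP.+-comm (ℤ.+ 1) (ℤ.- ℤ.+ k)) (ℤP.+-monoʳ-≤ (ℤ.+ 1) (ℤP.neg-mono-≤ hi)) ,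
  subst (ℤ.+ 1 ℤ.+ ℤ.- z ℤ.≤_) (one-minus-window-end (ℤ.+ k)) (ℤP.+-monoʳ-≤ (ℤ.+ 1) (ℤP.neg-mono-≤ lo))
  where
  open ℤSolver.+-*-Solver using () renaming (solve to ℤsolve; _:+_ to _⊞_; :-_ to ⊟_; con to ℤcon; _:=_ to _≐_)
  one-minus-window-end : ∀ a → ℤ.+ 1 ℤ.+ ℤ.- (ℤ.- a ℤ.+ ℤ.+ 1) ≡ a
  one-minus-window-end = ℤsolve 1 (λ a → ℤcon (ℤ.+ 1) ⊞ (⊟ ((⊟ a) ⊞ ℤcon (ℤ.+ 1))) ≐ a) refl

module RootSystem {n : ℕ} (M : Form n) (ip : IsInnerProduct M) (Φ : List (V n)) (rs : IsRootSystem M Φ)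
  (Δ : Fin n → V n) (bs : IsBase M Φ Δ) (ω : Fin n → V n) (fw : IsFundWeights M Δ ω) where

  open IsRootSystem rs
  open IsBase bs

  M-sym : ∀ i j → M i j ≡ M j i
  M-sym = proj₁ ip

  open FormGeometry M M-sym public

  root-norm-pos : ∀ α → α ∈ Φ → 0ℚ < ⟨ α , α ⟩
  root-norm-pos α α∈ = proj₂ ip α (λ α≡𝟎 → zero∉ (subst (_∈ Φ) α≡𝟎 α∈))

  root-nonIso : ∀ α → α ∈ Φ → NonIsotropic α
  root-nonIso α α∈ = pos⇒≢0 (root-norm-pos α α∈)

  open WeylWords M M-sym Φ root-nonIso reflClosed public
  open LinearCombination Δ public

  scale-pos : ∀ α → α ∈ Φ → 0ℚ < scale α
  scale-pos α α∈ = *-pos 0<two (inv-pos _ (root-norm-pos α α∈))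

  neg-root : ∀ α → α ∈ Φ → neg α ∈ Φ
  neg-root α α∈ = subst (_∈ Φ) (s-self α (root-nonIso α α∈)) (reflClosed α α α∈ α∈)

  Positive : V n → Set
  Positive = IsPositive M Δ

  ℕ-coeffs : (Fin n → ℕ) → Fin n → ℚ
  ℕ-coeffs c i = ι (ℤ.+ c i)

  positive-or-negative : ∀ α → α ∈ Φ → Positive α ⊎ Positive (neg α)
  positive-or-negative α α∈ with signed α α∈
  ... | c , α≡ , inj₁ c≥0 =
    inj₁ ((λ i → ℤ.∣ c i ∣) , trans α≡ (comb-cong λ i → cong ι (nonneg-ℤ (c i) (c≥0 i))))
  ... | c , α≡ , inj₂ c≤0 =
    inj₂ ((λ i → ℤ.∣ c i ∣) , trans (cong neg α≡) (trans (comb-· (- 1ℚ) (λ i → ι (c i)))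
      (comb-cong λ i → trans (solve 1 (λ x → (:- con 1ℚ) :* x := :- x) refl (ι (c i)))
                              (trans (sym (ι-neg (c i))) (cong ι (nonpos-ℤ (c i) (c≤0 i)))))))

  coords-unique : ∀ x y → comb x ≡ comb y → ∀ j → x j ≡ y j
  coords-unique x y x≡y = λ j → a-b≡0⇒a≡b (linIndep (λ j → x j - y j) difference≡𝟎 j)
    where
    open ≡-Reasoning
    difference≡𝟎 : comb (λ j → x j - y j) ≡ 𝟎
    difference≡𝟎 = begin
      comb (λ j → x j - y j)    ≡⟨ sym (comb-⊖ x y) ⟩
      comb x ⊖ comb y           ≡⟨ cong (_⊖ comb y) x≡y ⟩
      comb y ⊖ comb y           ≡⟨ ⊖-self (comb y) ⟩
      𝟎                         ∎

  -- a positive root γ = Σ cᵢαᵢ has an index i with cᵢ > 0 and ⟨αᵢ, γ⟩ > 0, because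
  -- 0 < ⟨γ, γ⟩ = Σ cᵢ ⟨αᵢ, γ⟩
  positive-support : ∀ c γ → γ ∈ Φ → γ ≡ comb (ℕ-coeffs c) →
    ∃ λ i → 0ℚ < ℕ-coeffs c i × 0ℚ < ⟨ Δ i , γ ⟩
  positive-support c γ γ∈ γ≡ = i , *-pos-factors (ι-nonneg (c i)) term-pos
    where
    norm-expansion : ⟨ γ , γ ⟩ ≡ sumQ (λ i → ℕ-coeffs c i * ⟨ Δ i , γ ⟩)
    norm-expansion = trans (cong (λ v → ⟨ v , γ ⟩) γ≡) (form-combˡ Δ (ℕ-coeffs c) γ)
    positive-term = sumQ-pos⇒∃ _ (subst (0ℚ <_) norm-expansion (root-norm-pos γ γ∈))
    i = proj₁ positive-term
    term-pos = proj₂ positive-term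

  -- Coroot integrality: γ^∨ lies in ⊕ ℤ αᵢ^∨, i.e. ⟨ωⱼ, γ^∨⟩ ∈ ℤ for all j.

  IntegralCoroot : V n → Set
  IntegralCoroot γ = ∀ j → IsInt ⟨ ω j , γ ⟩∨

  simple-integral : ∀ i → IntegralCoroot (Δ i)
  simple-integral i j = subst IsInt (sym (fw j i)) (int-δ j i)

  neg-integral : ∀ γ → IntegralCoroot γ → IntegralCoroot (neg γ)
  neg-integral γ p j = subst IsInt (sym (pair-neg (ω j) γ)) (int-neg (p j))

  -- (sᵢγ)^∨ = γ^∨ - ⟨αᵢ, γ^∨⟩ αᵢ^∨, read off against ωⱼ
  pair-ω-reflected : ∀ i j γ → ⟨ ω j , s (Δ i) γ ⟩∨ ≡ ⟨ ω j , γ ⟩∨ - ⟨ Δ i , γ ⟩∨ * δ j i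
  pair-ω-reflected i j γ = begin
      ⟨ ω j , coroot M (s (Δ i) γ) ⟩
    ≡⟨ cong ⟨ ω j ,_⟩ (coroot-s (Δ i) γ (root-nonIso (Δ i) (simple∈ i))) ⟩
      ⟨ ω j , s (Δ i) γ∨ ⟩
    ≡⟨ form-⊖ʳ (ω j) γ∨ (⟨ γ∨ , Δ i ⟩∨ · Δ i) ⟩
      ⟨ ω j , γ ⟩∨ - ⟨ ω j , ⟨ γ∨ , Δ i ⟩∨ · Δ i ⟩
    ≡⟨ cong (λ x → ⟨ ω j , γ ⟩∨ - x) (form-·ʳ (ω j) ⟨ γ∨ , Δ i ⟩∨ (Δ i)) ⟩
      ⟨ ω j , γ ⟩∨ - ⟨ γ∨ , Δ i ⟩∨ * ⟨ ω j , Δ i ⟩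
    ≡⟨ cong (λ x → ⟨ ω j , γ ⟩∨ - x) coefficient ⟩
      ⟨ ω j , γ ⟩∨ - ⟨ Δ i , γ ⟩∨ * δ j i
    ∎
    where
    open ≡-Reasoning
    γ∨ = coroot M γ
    coefficient : ⟨ γ∨ , Δ i ⟩∨ * ⟨ ω j , Δ i ⟩ ≡ ⟨ Δ i , γ ⟩∨ * δ j i
    coefficient = begin
        ⟨ γ∨ , Δ i ⟩∨ * ⟨ ω j , Δ i ⟩
      ≡⟨ cong (_* ⟨ ω j , Δ i ⟩) (pair-by-scale γ∨ (Δ i)) ⟩
        scale (Δ i) * ⟨ γ∨ , Δ i ⟩ * ⟨ ω j , Δ i ⟩
      ≡⟨ solve 3 (λ a b c → a :* b :* c := b :* (a :* c)) refl
           (scale (Δ i)) ⟨ γ∨ , Δ i ⟩ ⟨ ω j , Δ i ⟩ ⟩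
        ⟨ γ∨ , Δ i ⟩ * (scale (Δ i) * ⟨ ω j , Δ i ⟩)
      ≡⟨ cong₂ _*_ (form-sym γ∨ (Δ i))
           (trans (sym (pair-by-scale (ω j) (Δ i))) (fw j i)) ⟩
        ⟨ Δ i , γ ⟩∨ * δ j i
      ∎

  reflect-integral : ∀ i γ → γ ∈ Φ → IntegralCoroot γ → IntegralCoroot (s (Δ i) γ)
  reflect-integral i γ γ∈ p j = subst IsInt (sym (pair-ω-reflected i j γ))
    (int- (p j) (int* (integral γ (Δ i) γ∈ (simple∈ i)) (int-δ j i)))

  reflected-coords : ∀ x γ i z → γ ≡ comb x → ⟨ γ , Δ i ⟩∨ ≡ ι z →
    s (Δ i) γ ≡ comb (λ j → x j - δ i j * ι z)
  reflected-coords x γ i z γ≡ pair≡ = begin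
    s (Δ i) γ                            ≡⟨ cong₂ (λ u a → u ⊖ a · Δ i) γ≡ pair≡ ⟩
    comb x ⊖ ι z · Δ i                   ≡⟨ cong (comb x ⊖_) (comb-δ (ι z) i) ⟩
    comb x ⊖ comb (λ j → δ i j * ι z)    ≡⟨ comb-⊖ x (λ j → δ i j * ι z) ⟩
    comb (λ j → x j - δ i j * ι z)       ∎
    where open ≡-Reasoning

  reflected-height-drops : ∀ (c : Fin n → ℕ) i z (d : Fin n → ℤ) →
    (∀ j → ι (d j) ≡ ℕ-coeffs c j - δ i j * ι z) → (∀ j → ℤ.+ 0 ℤ.≤ d j) → 0ℚ < ι z →
    sumN (λ j → ℤ.∣ d j ∣) ℕ.< sumN c
  reflected-height-drops c i z d d≡ d≥0 z>0 =
    ℤP.drop‿+<+ (ι-cancel-< _ _ (subst (_< ι (ℤ.+ sumN c)) (sym height) (a-b<a _ _ z>0)))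
    where
    open ≡-Reasoning
    height : ι (ℤ.+ sumN (λ j → ℤ.∣ d j ∣)) ≡ ι (ℤ.+ sumN c) - ι z
    height = begin
        ι (ℤ.+ sumN (λ j → ℤ.∣ d j ∣))
      ≡⟨ ι-sumN (λ j → ℤ.∣ d j ∣) ⟩
        sumQ (λ j → ι (ℤ.+ ℤ.∣ d j ∣))
      ≡⟨ sumQ-cong (λ j → trans (cong ι (sym (nonneg-ℤ (d j) (d≥0 j)))) (d≡ j)) ⟩
        sumQ (λ j → ℕ-coeffs c j - δ i j * ι z)
      ≡⟨ sumQ-- (ℕ-coeffs c) (λ j → δ i j * ι z) ⟩
        sumQ (ℕ-coeffs c) - sumQ (λ j → δ i j * ι z)
      ≡⟨ cong₂ _-_ (sym (ι-sumN c)) (sumQ-δ i (λ _ → ι z)) ⟩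
        ι (ℤ.+ sumN c) - ι z
      ∎

  reflected-nonpositive : ∀ (c : Fin n → ℕ) i z (d : Fin n → ℤ) →
    (∀ j → ι (d j) ≡ ℕ-coeffs c j - δ i j * ι z) → (∀ j → d j ℤ.≤ ℤ.+ 0) →
    comb (ℕ-coeffs c) ≡ ℕ-coeffs c i · Δ i
  reflected-nonpositive c i z d d≡ d≤0 =
    trans (comb-cong (λ j → coordinate j (i Fin.≟ j))) (sym (comb-δ (ℕ-coeffs c i) i))
    where
    x = ℕ-coeffs c
    coordinate : ∀ j → Dec (i ≡ j) → x j ≡ δ i j * x i
    coordinate j (yes refl) = sym (trans (cong (_* x i) (δ-diag i)) (ℚP.*-identityˡ (x i)))
    coordinate j (no i≢j)   =
      trans (ℚP.≤-antisym xⱼ≤0 (ι-nonneg (c j))) (sym (trans (cong (_* x i) (δ-off i≢j)) (ℚP.*-zeroˡ (x i))))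
      where
      dⱼ≡xⱼ : ι (d j) ≡ x j
      dⱼ≡xⱼ = trans (d≡ j) (trans (cong (λ y → x j - y * ι z) (δ-off i≢j))
        (solve 2 (λ a b → a :- con 0ℚ :* b := a) refl (x j) (ι z)))
      xⱼ≤0 : x j ≤ 0ℚ
      xⱼ≤0 = subst (_≤ 0ℚ) dⱼ≡xⱼ (ι-mono-≤ (d j) (ℤ.+ 0) (d≤0 j))

  -- by reducedness a root a · αᵢ is ±αᵢ, whose coroot is integral
  simple-multiple-integral : ∀ i a → a · Δ i ∈ Φ → IntegralCoroot (a · Δ i)
  simple-multiple-integral i a a·αᵢ∈ with reduced (Δ i) a (simple∈ i) a·αᵢ∈
  ... | inj₁ refl = subst IntegralCoroot (sym (·-identity (Δ i))) (simple-integral i)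
  ... | inj₂ refl = neg-integral (Δ i) (simple-integral i)

  IntegralAtHeight : ℕ → Set
  IntegralAtHeight H = ∀ c γ → γ ∈ Φ → γ ≡ comb (ℕ-coeffs c) → sumN c ≡ H → IntegralCoroot γ

  -- Induction step on the height: choose i with ⟨αᵢ, γ⟩ > 0, so z = ⟨γ, αᵢ^∨⟩ is a positive
  -- integer.  Either sᵢγ is a positive root of smaller height, or γ is a multiple of αᵢ.
  height-descent : ∀ H → (∀ {H′} → H′ ℕ.< H → IntegralAtHeight H′) → IntegralAtHeight H
  height-descent _ ih c γ γ∈ γ≡ refl = by-sign (signed (s αᵢ γ) sγ∈)
    where
    support = positive-support c γ γ∈ γ≡
    i = proj₁ support
    αᵢ = Δ i
    αᵢ∈ = simple∈ i
    sγ∈ = reflClosed αᵢ γ αᵢ∈ γ∈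
    z = proj₁ (integral αᵢ γ αᵢ∈ γ∈)
    z≡ : ⟨ γ , αᵢ ⟩∨ ≡ ι z
    z≡ = proj₂ (integral αᵢ γ αᵢ∈ γ∈)
    z>0 : 0ℚ < ι z
    z>0 = subst (0ℚ <_) (trans (cong (scale αᵢ *_) (form-sym αᵢ γ)) (trans (sym (pair-by-scale γ αᵢ)) z≡))
                (*-pos (scale-pos αᵢ αᵢ∈) (proj₂ (proj₂ support)))
    sγ≡ : s αᵢ γ ≡ comb (λ j → ℕ-coeffs c j - δ i j * ι z)
    sγ≡ = reflected-coords (ℕ-coeffs c) γ i z γ≡ z≡
    coords-of : ∀ d → s αᵢ γ ≡ comb (λ j → ι (d j)) → ∀ j → ι (d j) ≡ ℕ-coeffs c j - δ i j * ι z
    coords-of d sγ≡d = coords-unique (λ j → ι (d j)) _ (trans (sym sγ≡d) sγ≡)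
    by-sign : (∃ λ d → s αᵢ γ ≡ comb (λ j → ι (d j)) × ((∀ j → ℤ.+ 0 ℤ.≤ d j) ⊎ (∀ j → d j ℤ.≤ ℤ.+ 0))) →
              IntegralCoroot γ
    by-sign (d , sγ≡d , inj₁ d≥0) =
      subst IntegralCoroot (s-involutive αᵢ γ (root-nonIso αᵢ αᵢ∈))
        (reflect-integral i (s αᵢ γ) sγ∈
          (ih (reflected-height-drops c i z d (coords-of d sγ≡d) d≥0 z>0) (λ j → ℤ.∣ d j ∣) (s αᵢ γ) sγ∈
              (trans sγ≡d (comb-cong λ j → cong ι (nonneg-ℤ (d j) (d≥0 j)))) refl))
    by-sign (d , sγ≡d , inj₂ d≤0) =
      subst IntegralCoroot (sym γ≡αᵢ) (simple-multiple-integral i (ℕ-coeffs c i) (subst (_∈ Φ) γ≡αᵢ γ∈))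
      where
      γ≡αᵢ : γ ≡ ℕ-coeffs c i · αᵢ
      γ≡αᵢ = trans γ≡ (reflected-nonpositive c i z d (coords-of d sγ≡d) d≤0)

  coroot-integral : ∀ γ → γ ∈ Φ → IntegralCoroot γ
  coroot-integral γ γ∈ with positive-or-negative γ γ∈
  ... | inj₁ (c , γ≡)  = <-rec IntegralAtHeight height-descent (sumN c) c γ γ∈ γ≡ refl
  ... | inj₂ (c , -γ≡) = subst IntegralCoroot (neg-involutive γ)
    (neg-integral (neg γ) (<-rec IntegralAtHeight height-descent (sumN c) c (neg γ) (neg-root γ γ∈) -γ≡ refl))

  IntegralWeight : V n → Set
  IntegralWeight v = ∀ γ → γ ∈ Φ → IsInt ⟨ v , γ ⟩∨

  weight⇒integral : ∀ v → InP M ω v → IntegralWeight v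
  weight⇒integral v (c , v≡) γ γ∈ = subst IsInt (sym expansion)
    (int-sumQ _ (λ i → int* (c i , refl) (coroot-integral γ γ∈ i)))
    where
    expansion : ⟨ v , γ ⟩∨ ≡ sumQ (λ i → ι (c i) * ⟨ ω i , γ ⟩∨)
    expansion = trans (cong (λ u → ⟨ u , γ ⟩∨) v≡)
      (trans (pair-sumV (λ i → ι (c i) · ω i) γ) (sumQ-cong λ i → pair-· (ι (c i)) (ω i) γ))

  -- a vector orthogonal to the base is orthogonal to Φ, hence to V = span Φ, hence zero
  orthogonal-to-base⇒𝟎 : ∀ d → (∀ k → ⟨ d , Δ k ⟩ ≡ 0ℚ) → d ≡ 𝟎
  orthogonal-to-base⇒𝟎 d d⊥Δ with VecP.≡-dec ℚP._≟_ d 𝟎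
  ... | yes d≡𝟎 = d≡𝟎
  ... | no d≢𝟎  = ⊥-elim (ℚP.<-irrefl (sym ⟨d,d⟩≡0) (proj₂ ip d d≢𝟎))
    where
    d⊥Φ : ∀ β → β ∈ Φ → ⟨ d , β ⟩ ≡ 0ℚ
    d⊥Φ β β∈ with signed β β∈
    ... | c , β≡ , _ = trans (cong ⟨ d ,_⟩ β≡) (trans (form-combʳ Δ (λ j → ι (c j)) d)
      (sumQ-vanish _ λ j → trans (cong (ι (c j) *_) (d⊥Δ j)) (ℚP.*-zeroʳ (ι (c j)))))
    ⟨d,d⟩≡0 : ⟨ d , d ⟩ ≡ 0ℚ
    ⟨d,d⟩≡0 with spans d
    ... | c , d≡ = trans (cong ⟨ d ,_⟩ d≡) (trans (form-combʳ (List.lookup Φ) c d)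
      (sumQ-vanish _ λ i → trans (cong (c i *_) (d⊥Φ _ (∈-lookup i))) (ℚP.*-zeroʳ (c i))))

  -- an integral weight v equals Σⱼ ⟨v, αⱼ^∨⟩ ωⱼ, since the difference is orthogonal to the base
  integral⇒weight : ∀ v → IntegralWeight v → InP M ω v
  integral⇒weight v v-int = c , v≡u
    where
    c : Fin n → ℤ
    c j = proj₁ (v-int (Δ j) (simple∈ j))
    u = sumV (λ j → ι (c j) · ω j)
    same-pairing : ∀ k → ⟨ u , Δ k ⟩∨ ≡ ⟨ v , Δ k ⟩∨
    same-pairing k = trans (pair-sumV (λ j → ι (c j) · ω j) (Δ k))
      (trans (sumQ-cong λ j → trans (pair-· (ι (c j)) (ω j) (Δ k)) (cong (ι (c j) *_) (fw j k)))
        (trans (sumQ-δʳ k (λ j → ι (c j))) (sym (proj₂ (v-int (Δ k) (simple∈ k))))))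
    v-u⊥Δ : ∀ k → ⟨ v ⊖ u , Δ k ⟩ ≡ 0ℚ
    v-u⊥Δ k = *-cancel-pos (scale-pos (Δ k) (simple∈ k)) (begin
      scale (Δ k) * ⟨ v ⊖ u , Δ k ⟩       ≡⟨ sym (pair-by-scale (v ⊖ u) (Δ k)) ⟩
      ⟨ v ⊖ u , Δ k ⟩∨                    ≡⟨ pair-⊖ v u (Δ k) ⟩
      ⟨ v , Δ k ⟩∨ - ⟨ u , Δ k ⟩∨         ≡⟨ cong (λ x → ⟨ v , Δ k ⟩∨ - x) (same-pairing k) ⟩
      ⟨ v , Δ k ⟩∨ - ⟨ v , Δ k ⟩∨         ≡⟨ ℚP.+-inverseʳ ⟨ v , Δ k ⟩∨ ⟩
      0ℚ                                  ∎)
      where open ≡-Reasoning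
    v≡u : v ≡ u
    v≡u = ext λ k → a-b≡0⇒a≡b (trans (sym (lookup-⊖ v u k))
      (trans (cong (λ x → lookup x k) (orthogonal-to-base⇒𝟎 (v ⊖ u) v-u⊥Δ)) (lookup-𝟎 k)))

  integral-⊕ : ∀ u v → IntegralWeight u → IntegralWeight v → IntegralWeight (u ⊕ v)
  integral-⊕ u v u-int v-int γ γ∈ = subst IsInt (sym (pair-⊕ u v γ)) (int+ (u-int γ γ∈) (v-int γ γ∈))

  integral-neg : ∀ u → IntegralWeight u → IntegralWeight (neg u)
  integral-neg u u-int γ γ∈ = subst IsInt (sym (pair-· (- 1ℚ) u γ)) (int* (int-neg int1) (u-int γ γ∈))

  integral-⊳ : ∀ w → IsWord w → ∀ u → IntegralWeight u → IntegralWeight (w ⊳ u)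
  integral-⊳ []      _          u u-int = u-int
  integral-⊳ (α ∷ w) (α∈ ∷ ws) u u-int γ γ∈ = subst IsInt (sym reflected)
    (int- (wu-int γ γ∈) (int* (wu-int α α∈) (integral γ α γ∈ α∈)))
    where
    wu-int = integral-⊳ w ws u u-int
    reflected : ⟨ s α (w ⊳ u) , γ ⟩∨ ≡ ⟨ w ⊳ u , γ ⟩∨ - ⟨ w ⊳ u , α ⟩∨ * ⟨ α , γ ⟩∨
    reflected = trans (pair-⊖ (w ⊳ u) _ γ) (cong (λ x → ⟨ w ⊳ u , γ ⟩∨ - x) (pair-· ⟨ w ⊳ u , α ⟩∨ α γ))

  weight-⊳ : ∀ w → IsWord w → ∀ u → InP M ω u → InP M ω (w ⊳ u)
  weight-⊳ w ws u u∈P = integral⇒weight _ (integral-⊳ w ws u (weight⇒integral u u∈P))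

  -- k is invariant under α ↦ -α = s_α α
  k-neg : ∀ (k : V n → ℕ) → IsWInvariant M Φ k → ∀ γ → γ ∈ Φ → k (neg γ) ≡ k γ
  k-neg k k-inv γ γ∈ = trans (cong k (sym (s-self γ (root-nonIso γ γ∈)))) (k-inv (γ ∷ []) (γ∈ ∷ []) γ γ∈)

  -- Part (1): w maps an edge l → l+α to w(l) → w(l)+w(α), read backwards along -w(α) when
  -- w(α) is negative; then ⟨·, (-γ)^∨⟩ + 1 flips sign, which the symmetric window allows.
  symmetric-edge : ∀ (k : V n → ℕ) → IsWInvariant M Φ k → ∀ w → IsWord w →
    ∀ l m → symRel M Φ Δ k l m → Undirected (symRel M Φ Δ k) (w ⊳ l) (w ⊳ m)
  symmetric-edge k k-inv w ws l m (α , α∈ , _ , m≡ , z , z≡ , window) = by-sign (positive-or-negative γ γ∈)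
    where
    γ = w ⊳ α
    γ∈ = ⊳-root w ws α α∈
    kγ : k γ ≡ k α
    kγ = k-inv w ws α α∈
    wm≡ : w ⊳ m ≡ w ⊳ l ⊕ γ
    wm≡ = trans (cong (w ⊳_) m≡) (⊳-⊕ w l α)
    pair≡ : ⟨ w ⊳ l , γ ⟩∨ + 1ℚ ≡ ι z
    pair≡ = trans (cong (_+ 1ℚ) (⊳-pair w ws l α)) z≡
    by-sign : Positive γ ⊎ Positive (neg γ) → Undirected (symRel M Φ Δ k) (w ⊳ l) (w ⊳ m)
    by-sign (inj₁ γ>0)  = inj₁ (γ , γ∈ , γ>0 , wm≡ , z , pair≡ , subst (λ q → SymWindow q z) (sym kγ) window)
    by-sign (inj₂ -γ>0) = inj₂ (neg γ , neg-root γ γ∈ , -γ>0 ,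
      sym (trans (cong (_⊕ neg γ) wm≡) (⊕-neg-cancel (w ⊳ l) γ)) , ℤ.- z ,
      trans (cong (λ x → ⟨ x , neg γ ⟩∨ + 1ℚ) wm≡)
        (trans (pair-reversed (w ⊳ l) γ (root-nonIso γ γ∈)) (trans (cong -_ pair≡) (sym (ι-neg z)))) ,
      subst (λ q → SymWindow q (ℤ.- z)) (sym (trans (k-neg k k-inv γ γ∈) kγ)) (sym-window-flip (k α) z window))

  symmetric-automorphism : ∀ (k : V n → ℕ) → IsWInvariant M Φ k → ∀ w → IsWord w →
    IsAutomorphism (InP M ω) (Undirected (symRel M Φ Δ k)) (act M w)
  symmetric-automorphism k k-inv w ws =
    automorphism-from-inverse (InP M ω) (Undirected (symRel M Φ Δ k)) (w ⊳_) (reverse w ⊳_)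
      (weight-⊳ w ws) (weight-⊳ (reverse w) (reverse-word w ws)) (reverse-⊳ˡ w ws) (reverse-⊳ʳ w ws)
      (undirected-preserved _ (w ⊳_) (symmetric-edge k k-inv w ws))
      (undirected-preserved _ (reverse w ⊳_) (symmetric-edge k k-inv (reverse w) (reverse-word w ws)))

module Coxeter {n : ℕ} (M : Form n) (ip : IsInnerProduct M) (Φ : List (V n)) (rs : IsRootSystem M Φ)
  (Δ : Fin n → V n) (bs : IsBase M Φ Δ) (ω : Fin n → V n) (fw : IsFundWeights M Δ ω)
  (θ : V n) (hc : IsHighestCoroot M Φ Δ θ) where

  open RootSystem M ip Φ rs Δ bs ω fw
  open IsBase bs

  ρω : V n
  ρω = ρ M ω

  H h : ℚ
  H = ⟨ ρω , θ ⟩∨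
  h = coxeter M ω θ

  0<1 : 0ℚ < 1ℚ
  0<1 = ℚP.positive⁻¹ 1ℚ

  ρ-simple : ∀ i → ⟨ ρω , Δ i ⟩∨ ≡ 1ℚ
  ρ-simple i = trans (pair-sumV ω (Δ i))
    (trans (sumQ-cong λ j → trans (fw j i) (sym (ℚP.*-identityˡ (δ j i)))) (sumQ-δʳ i (λ _ → 1ℚ)))

  ρ-simple-pos : ∀ i → 0ℚ < ⟨ ρω , Δ i ⟩
  ρ-simple-pos i = proj₂ (*-pos-factors (ℚP.<⇒≤ (scale-pos (Δ i) (simple∈ i)))
    (subst (0ℚ <_) (trans (sym (ρ-simple i)) (pair-by-scale ρω (Δ i))) 0<1))

  ρ-integral : ∀ γ → γ ∈ Φ → IsInt ⟨ ρω , γ ⟩∨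
  ρ-integral γ γ∈ = subst IsInt (sym (pair-sumV ω γ)) (int-sumQ _ (coroot-integral γ γ∈))

  -- 1 ≤ ⟨ρ, γ^∨⟩ for positive γ: ⟨ρ, γ⟩ = Σ cᵢ⟨ρ, αᵢ⟩ > 0 and the pairing is an integer
  ρ-lower : ∀ γ → γ ∈ Φ → Positive γ → 1ℚ ≤ ⟨ ρω , γ ⟩∨
  ρ-lower γ γ∈ (c , γ≡) =
    int-pos⇒≥1 (ρ-integral γ γ∈) (subst (0ℚ <_) (sym (pair-by-scale ρω γ)) (*-pos (scale-pos γ γ∈) ⟨ρ,γ⟩>0))
    where
    support = positive-support c γ γ∈ γ≡
    i = proj₁ support
    ⟨ρ,γ⟩>0 : 0ℚ < ⟨ ρω , γ ⟩
    ⟨ρ,γ⟩>0 = subst (0ℚ <_) (sym (trans (cong ⟨ ρω ,_⟩ γ≡) (form-combʳ Δ (ℕ-coeffs c) ρω)))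
      (sumQ-pos _ (λ j → *-nonneg (ι-nonneg (c j)) (ℚP.<⇒≤ (ρ-simple-pos j))) i
        (*-pos (proj₁ (proj₂ support)) (ρ-simple-pos i)))

  -- ⟨ρ, γ^∨⟩ ≤ ⟨ρ, θ^∨⟩ = H, since θ^∨ - γ^∨ is a nonnegative combination of simple coroots
  ρ-upper : ∀ γ → γ ∈ Φ → ⟨ ρω , γ ⟩∨ ≤ H
  ρ-upper γ γ∈ = 0≤b-a⇒a≤b (subst (0ℚ ≤_) (sym difference)
    (sumQ-nonneg _ λ i → subst (0ℚ ≤_) (sym (trans (cong (ℕ-coeffs c i *_) (ρ-simple i)) (ℚP.*-identityʳ _)))
                                (ι-nonneg (c i))))
    where
    c = proj₁ (proj₂ hc γ γ∈)
    difference : H - ⟨ ρω , γ ⟩∨ ≡ sumQ (λ i → ℕ-coeffs c i * ⟨ ρω , Δ i ⟩∨)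
    difference = trans (sym (form-⊖ʳ ρω (coroot M θ) (coroot M γ)))
      (trans (cong ⟨ ρω ,_⟩ (proj₂ (proj₂ hc γ γ∈))) (form-combʳ (coroot M ∘ Δ) (ℕ-coeffs c) ρω))

  ρ-bounds : ∀ γ → γ ∈ Φ → Positive γ → 1ℚ ≤ ⟨ ρω , γ ⟩∨ × ⟨ ρω , γ ⟩∨ ≤ H
  ρ-bounds γ γ∈ γ>0 = ρ-lower γ γ∈ γ>0 , ρ-upper γ γ∈

  -- h = H + 1 > 0, since H ≥ 1 by the bounds applied to ±θ
  h>0 : 0ℚ < h
  h>0 with positive-or-negative θ (proj₁ hc)
  ... | inj₁ θ>0  = ℚP.+-mono-≤-< (ℚP.≤-trans (ℚP.<⇒≤ 0<1) (ρ-lower θ (proj₁ hc) θ>0)) 0<1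
  ... | inj₂ -θ>0 = ℚP.+-mono-≤-< (ℚP.≤-trans (ℚP.<⇒≤ 0<1)
                      (ℚP.≤-trans (ρ-lower _ -θ∈ -θ>0) (ρ-upper _ -θ∈))) 0<1
    where -θ∈ = neg-root θ (proj₁ hc)

  -- for A, B ∈ [1, H] both A - B and h - A - B lie strictly between -h and h; each bound
  -- q - p is a sum u + v + 2 of two distances u, v ≥ 0 to the ends of [1, H]
  window-gaps : ∀ A B → 1ℚ ≤ A × A ≤ H → 1ℚ ≤ B × B ≤ H →
    (- h < A - B × A - B < h) × (- h < (- A - B) + h × (- A - B) + h < h)
  window-gaps A B (1≤A , A≤H) (1≤B , B≤H) =
    (by-margin (0≤b-a 1≤A) (0≤b-a B≤H)
       (solve 3 (λ A B H → (A :- con 1ℚ) :+ (H :- B) :+ two′ := (A :- B) :- (:- (H :+ con 1ℚ))) refl A B H) ,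
     by-margin (0≤b-a A≤H) (0≤b-a 1≤B)
       (solve 3 (λ A B H → (H :- A) :+ (B :- con 1ℚ) :+ two′ := (H :+ con 1ℚ) :- (A :- B)) refl A B H)) ,
    (by-margin (0≤b-a A≤H) (0≤b-a B≤H)
       (solve 3 (λ A B H → (H :- A) :+ (H :- B) :+ two′
                           := ((:- A :- B) :+ (H :+ con 1ℚ)) :- (:- (H :+ con 1ℚ))) refl A B H) ,
     by-margin (0≤b-a 1≤A) (0≤b-a 1≤B)
       (solve 3 (λ A B H → (A :- con 1ℚ) :+ (B :- con 1ℚ) :+ two′
                           := (H :+ con 1ℚ) :- ((:- A :- B) :+ (H :+ con 1ℚ))) refl A B H))
    where
    two′ = con 1ℚ :+ con 1ℚ
    by-margin : ∀ {p q u v} → 0ℚ ≤ u → 0ℚ ≤ v → u + v + two ≡ q - p → p < q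
    by-margin 0≤u 0≤v q-p≡ = 0<b-a⇒a<b (subst (0ℚ <_) q-p≡ (ℚP.+-mono-≤-< (ℚP.+-mono-≤ 0≤u 0≤v) 0<two))

  small-multiple⇒0 : ∀ {q} → IsInt q → - h < h * q → h * q < h → q ≡ 0ℚ
  small-multiple⇒0 {q} q-int lo hi = int-between⇒0 q-int
    (ℚP.*-cancelˡ-<-nonNeg h {{ℚ.nonNegative (ℚP.<⇒≤ h>0)}}
      (subst (_< h * q) (solve 1 (λ h → :- h := h :* (:- con 1ℚ)) refl h) lo))
    (ℚP.*-cancelˡ-<-nonNeg h {{ℚ.nonNegative (ℚP.<⇒≤ h>0)}} (subst (h * q <_) (sym (ℚP.*-identityʳ h)) hi))

  module ShiftedAction (k : V n → ℕ) (k-inv : IsWInvariant M Φ k) (w : List (V n)) (ws : IsWord w)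
    (μ : V n) (μ-int : IntegralWeight μ) (hμ : ρω ⊖ w ⊳ ρω ≡ h · μ) where

    F : V n → V n
    F l = w ⊳ l ⊕ μ

    F-weight : ∀ l → InP M ω l → InP M ω (F l)
    F-weight l l∈P =
      integral⇒weight (F l) (integral-⊕ (w ⊳ l) μ (integral-⊳ w ws l (weight⇒integral l l∈P)) μ-int)

    shift-pairing : ∀ α → h * ⟨ μ , w ⊳ α ⟩∨ ≡ ⟨ ρω , w ⊳ α ⟩∨ - ⟨ ρω , α ⟩∨
    shift-pairing α = begin
      h * ⟨ μ , w ⊳ α ⟩∨                        ≡⟨ sym (pair-· h μ (w ⊳ α)) ⟩
      ⟨ h · μ , w ⊳ α ⟩∨                        ≡⟨ cong ⟨_, w ⊳ α ⟩∨ (sym hμ) ⟩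
      ⟨ ρω ⊖ w ⊳ ρω , w ⊳ α ⟩∨                  ≡⟨ pair-⊖ ρω (w ⊳ ρω) (w ⊳ α) ⟩
      ⟨ ρω , w ⊳ α ⟩∨ - ⟨ w ⊳ ρω , w ⊳ α ⟩∨     ≡⟨ cong (λ x → ⟨ ρω , w ⊳ α ⟩∨ - x) (⊳-pair w ws ρω α) ⟩
      ⟨ ρω , w ⊳ α ⟩∨ - ⟨ ρω , α ⟩∨             ∎
      where open ≡-Reasoning

    shift-positive : ∀ α → α ∈ Φ → Positive α → Positive (w ⊳ α) → ⟨ μ , w ⊳ α ⟩∨ ≡ 0ℚ
    shift-positive α α∈ α>0 γ>0 = small-multiple⇒0 (μ-int (w ⊳ α) γ∈)
      (subst (- h <_) (sym (shift-pairing α)) (proj₁ gap)) (subst (_< h) (sym (shift-pairing α)) (proj₂ gap))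
      where
      γ∈ = ⊳-root w ws α α∈
      gap = proj₁ (window-gaps _ _ (ρ-bounds (w ⊳ α) γ∈ γ>0) (ρ-bounds α α∈ α>0))

    shift-negative : ∀ α → α ∈ Φ → Positive α → Positive (neg (w ⊳ α)) → ⟨ μ , w ⊳ α ⟩∨ + 1ℚ ≡ 0ℚ
    shift-negative α α∈ α>0 -γ>0 = small-multiple⇒0 (int+ (μ-int γ γ∈) int1)
      (subst (- h <_) (sym shifted) (proj₁ gap)) (subst (_< h) (sym shifted) (proj₂ gap))
      where
      open ≡-Reasoning
      γ = w ⊳ α
      γ∈ = ⊳-root w ws α α∈
      A′ = ⟨ ρω , neg γ ⟩∨
      -A′≡ : - A′ ≡ ⟨ ρω , γ ⟩∨
      -A′≡ = trans (cong -_ (pair-neg ρω γ)) (solve 1 (λ x → :- (:- x) := x) refl ⟨ ρω , γ ⟩∨)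
      gap = proj₂ (window-gaps _ _ (ρ-bounds (neg γ) (neg-root γ γ∈) -γ>0) (ρ-bounds α α∈ α>0))
      shifted : h * (⟨ μ , γ ⟩∨ + 1ℚ) ≡ (- A′ - ⟨ ρω , α ⟩∨) + h
      shifted = begin
          h * (⟨ μ , γ ⟩∨ + 1ℚ)
        ≡⟨ trans (ℚP.*-distribˡ-+ h _ 1ℚ) (cong₂ _+_ (shift-pairing α) (ℚP.*-identityʳ h)) ⟩
          (⟨ ρω , γ ⟩∨ - ⟨ ρω , α ⟩∨) + h
        ≡⟨ cong (λ x → (x - ⟨ ρω , α ⟩∨) + h) (sym -A′≡) ⟩
          (- A′ - ⟨ ρω , α ⟩∨) + h
        ∎

    truncated-edge : ∀ l m → trRel M Φ Δ k l m → Undirected (trRel M Φ Δ k) (F l) (F m)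
    truncated-edge l m (α , α∈ , α>0 , m≡ , z , z≡ , window) = by-sign (positive-or-negative γ γ∈)
      where
      γ = w ⊳ α
      γ∈ = ⊳-root w ws α α∈
      kγ : k γ ≡ k α
      kγ = k-inv w ws α α∈
      Fm≡ : F m ≡ F l ⊕ γ
      Fm≡ = trans (cong (λ x → w ⊳ x ⊕ μ) m≡) (trans (cong (_⊕ μ) (⊳-⊕ w l α)) (⊕-swap (w ⊳ l) γ μ))
      pair-F : ⟨ F l , γ ⟩∨ + 1ℚ ≡ (⟨ l , α ⟩∨ + 1ℚ) + ⟨ μ , γ ⟩∨
      pair-F = trans (cong (_+ 1ℚ) (trans (pair-⊕ (w ⊳ l) μ γ) (cong (_+ ⟨ μ , γ ⟩∨) (⊳-pair w ws l α))))
        (solve 2 (λ p q → (p :+ q) :+ con 1ℚ := (p :+ con 1ℚ) :+ q) refl ⟨ l , α ⟩∨ ⟨ μ , γ ⟩∨)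
      by-sign : Positive γ ⊎ Positive (neg γ) → Undirected (trRel M Φ Δ k) (F l) (F m)
      by-sign (inj₁ γ>0) = inj₁ (γ , γ∈ , γ>0 , Fm≡ , z ,
        trans pair-F (trans (cong₂ _+_ z≡ (shift-positive α α∈ α>0 γ>0)) (ℚP.+-identityʳ (ι z))) ,
        subst (λ q → TrWindow q z) (sym kγ) window)
      by-sign (inj₂ -γ>0) = inj₂ (neg γ , neg-root γ γ∈ , -γ>0 ,
        sym (trans (cong (_⊕ neg γ) Fm≡) (⊕-neg-cancel (F l) γ)) , ℤ.+ 1 ℤ.+ ℤ.- z ,
        trans (cong (λ x → ⟨ x , neg γ ⟩∨ + 1ℚ) Fm≡) (trans (pair-reversed (F l) γ (root-nonIso γ γ∈)) reversed) ,
        subst (λ q → TrWindow q (ℤ.+ 1 ℤ.+ ℤ.- z)) (sym (trans (k-neg k k-inv γ γ∈) kγ)) (tr-window-flip (k α) z window))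
        where
        open ≡-Reasoning
        reversed : - (⟨ F l , γ ⟩∨ + 1ℚ) ≡ ι (ℤ.+ 1 ℤ.+ ℤ.- z)
        reversed = begin
            - (⟨ F l , γ ⟩∨ + 1ℚ)
          ≡⟨ cong -_ pair-F ⟩
            - ((⟨ l , α ⟩∨ + 1ℚ) + ⟨ μ , γ ⟩∨)
          ≡⟨ cong (λ x → - (x + ⟨ μ , γ ⟩∨)) z≡ ⟩
            - (ι z + ⟨ μ , γ ⟩∨)
          ≡⟨ solve 2 (λ x q → :- (x :+ q) := con 1ℚ :+ (:- x) :- (q :+ con 1ℚ)) refl (ι z) ⟨ μ , γ ⟩∨ ⟩
            1ℚ + - ι z - (⟨ μ , γ ⟩∨ + 1ℚ)
          ≡⟨ cong (λ x → 1ℚ + - ι z - x) (shift-negative α α∈ α>0 -γ>0) ⟩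
            1ℚ + - ι z - 0ℚ
          ≡⟨ solve 1 (λ x → con 1ℚ :+ (:- x) :- con 0ℚ := con 1ℚ :+ (:- x)) refl (ι z) ⟩
            1ℚ + - ι z
          ≡⟨ sym (trans (ι-+ (ℤ.+ 1) (ℤ.- z)) (cong (1ℚ +_) (ι-neg z))) ⟩
            ι (ℤ.+ 1 ℤ.+ ℤ.- z)
          ∎

  affine≡shift : ∀ w → ∀ μ → ρω ⊖ w ⊳ ρω ≡ h · μ → ∀ v →
    w ⊳ (v ⊖ inv h · ρω) ⊕ inv h · ρω ≡ w ⊳ v ⊕ μ
  affine≡shift w μ hμ v = begin
      w ⊳ (v ⊖ inv h · ρω) ⊕ inv h · ρω
    ≡⟨ cong (_⊕ inv h · ρω) (trans (⊳-⊖ w v _) (cong (w ⊳ v ⊖_) (⊳-· w (inv h) ρω))) ⟩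
      (w ⊳ v ⊖ inv h · (w ⊳ ρω)) ⊕ inv h · ρω
    ≡⟨ ⊖-⊕-scaled (inv h) (w ⊳ v) (w ⊳ ρω) ρω ⟩
      w ⊳ v ⊕ inv h · (ρω ⊖ w ⊳ ρω)
    ≡⟨ cong (λ x → w ⊳ v ⊕ inv h · x) hμ ⟩
      w ⊳ v ⊕ inv h · (h · μ)
    ≡⟨ cong (w ⊳ v ⊕_) (·-inverse h μ (pos⇒≢0 h>0)) ⟩
      w ⊳ v ⊕ μ
    ∎
    where open ≡-Reasoning

  -- The inverse of v ↦ w(v) + μ is v ↦ w⁻¹(v) - w⁻¹(μ), of the same shape for the reversed word.
  truncated-automorphism : ∀ (k : V n → ℕ) → IsWInvariant M Φ k → ∀ w → InC M Φ ω θ w →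
    IsAutomorphism (InP M ω) (Undirected (trRel M Φ Δ k)) (λ v → w ⊳ (v ⊖ inv h · ρω) ⊕ inv h · ρω)
  truncated-automorphism k k-inv w (ws , μ , μ∈P , hμ) =
    automorphism-cong _ _ Forward.F _ (λ v → sym (affine≡shift w μ hμ v))
      (automorphism-from-inverse _ _ Forward.F Backward.F Forward.F-weight Backward.F-weight
        backward∘forward forward∘backward
        (undirected-preserved _ Forward.F Forward.truncated-edge)
        (undirected-preserved _ Backward.F Backward.truncated-edge))
    where
    open ≡-Reasoning
    μ-int = weight⇒integral μ μ∈P
    w⁻¹ = reverse w
    ws⁻¹ = reverse-word w ws
    μ⁻¹ = neg (w⁻¹ ⊳ μ)
    hμ⁻¹ : ρω ⊖ w⁻¹ ⊳ ρω ≡ h · μ⁻¹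
    hμ⁻¹ = begin
      ρω ⊖ w⁻¹ ⊳ ρω                     ≡⟨ sym (neg-⊖ (w⁻¹ ⊳ ρω) ρω) ⟩
      neg (w⁻¹ ⊳ ρω ⊖ ρω)               ≡⟨ cong (λ x → neg (w⁻¹ ⊳ ρω ⊖ x)) (sym (reverse-⊳ˡ w ws ρω)) ⟩
      neg (w⁻¹ ⊳ ρω ⊖ w⁻¹ ⊳ w ⊳ ρω)     ≡⟨ cong neg (sym (⊳-⊖ w⁻¹ ρω (w ⊳ ρω))) ⟩
      neg (w⁻¹ ⊳ (ρω ⊖ w ⊳ ρω))         ≡⟨ cong (λ x → neg (w⁻¹ ⊳ x)) hμ ⟩
      neg (w⁻¹ ⊳ (h · μ))               ≡⟨ cong neg (⊳-· w⁻¹ h μ) ⟩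
      neg (h · (w⁻¹ ⊳ μ))               ≡⟨ sym (·-neg h (w⁻¹ ⊳ μ)) ⟩
      h · μ⁻¹                           ∎
    module Forward = ShiftedAction k k-inv w ws μ μ-int hμ
    μ⁻¹-int = integral-neg (w⁻¹ ⊳ μ) (integral-⊳ w⁻¹ ws⁻¹ μ μ-int)
    module Backward = ShiftedAction k k-inv w⁻¹ ws⁻¹ μ⁻¹ μ⁻¹-int hμ⁻¹
    backward∘forward : ∀ l → w⁻¹ ⊳ (w ⊳ l ⊕ μ) ⊕ μ⁻¹ ≡ l
    backward∘forward l = begin
      w⁻¹ ⊳ (w ⊳ l ⊕ μ) ⊕ μ⁻¹               ≡⟨ cong (_⊕ μ⁻¹) (⊳-⊕ w⁻¹ (w ⊳ l) μ) ⟩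
      (w⁻¹ ⊳ w ⊳ l ⊕ w⁻¹ ⊳ μ) ⊕ μ⁻¹          ≡⟨ cong (λ x → (x ⊕ w⁻¹ ⊳ μ) ⊕ μ⁻¹) (reverse-⊳ˡ w ws l) ⟩
      (l ⊕ w⁻¹ ⊳ μ) ⊕ μ⁻¹                    ≡⟨ ⊕-neg-cancel l (w⁻¹ ⊳ μ) ⟩
      l                                      ∎
    forward∘backward : ∀ m → w ⊳ (w⁻¹ ⊳ m ⊕ μ⁻¹) ⊕ μ ≡ m
    forward∘backward m = begin
        w ⊳ (w⁻¹ ⊳ m ⊕ μ⁻¹) ⊕ μ
      ≡⟨ cong (_⊕ μ) (⊳-⊕ w (w⁻¹ ⊳ m) μ⁻¹) ⟩
        (w ⊳ w⁻¹ ⊳ m ⊕ w ⊳ μ⁻¹) ⊕ μ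
      ≡⟨ cong₂ (λ x y → (x ⊕ y) ⊕ μ) (reverse-⊳ʳ w ws m)
           (trans (⊳-· w (- 1ℚ) (w⁻¹ ⊳ μ)) (cong neg (reverse-⊳ʳ w ws μ))) ⟩
        (m ⊕ neg μ) ⊕ μ
      ≡⟨ neg-⊕-cancel m μ ⟩
        m
      ∎

theorem5p1 : ∀ (n : ℕ) (M : Form n) → IsInnerProduct M →
    (Φ : List (V n)) → IsRootSystem M Φ → IsIrreducible M Φ →
    (Δ : Fin n → V n) → IsBase M Φ Δ →
    (ω : Fin n → V n) → IsFundWeights M Δ ω →
    (θ : V n) → IsHighestCoroot M Φ Δ θ →
    (k : V n → ℕ) → IsWInvariant M Φ k →
    (∀ w → InW M Φ w →
      IsAutomorphism (InP M ω) (Undirected (symRel M Φ Δ k)) (act M w)) ×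
    (∀ w → InC M Φ ω θ w →
      IsAutomorphism (InP M ω) (Undirected (trRel M Φ Δ k))
        (λ v → _⊕_ (act M w (_⊖_ v (_·_ (inv (coxeter M ω θ)) (ρ M ω))))
                   (_·_ (inv (coxeter M ω θ)) (ρ M ω))))
theorem5p1 n M ip Φ rs _ Δ bs ω fw θ hc k k-inv =
  RootSystem.symmetric-automorphism M ip Φ rs Δ bs ω fw k k-inv ,
  Coxeter.truncated-automorphism M ip Φ rs Δ bs ω fw θ hc k k-inv
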